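{- \[ \sum_{\lambda \in \mathcal{P}_{2,b}} t^{\mathrm{odd}(\lambda)} q^{|\lambda|} = \sum_{n \geq 0} \frac{t^n q^{n^2} (-1; q^2)_{n}}{(t q; q^2)_n (q^2; q^2)_n}, \] where $\mathrm{odd}(\lambda)$ is the number of odd parts of $\lambda$ (with multiplicity) and $|\lambda|$ its weight.
   Context: Colours are $a,b,c$ (indexed $c_0=a$, $c_1=b$, $c_2=c$). A grounded partition in $\mathcal{P}_{2,b}$ is a finite (possibly empty) sequence $(\lambda_1,\dots,\lambda_\ell)$ of positive integers, each carrying a colour in $\{a,b,c\}$, such that, setting $\lambda_0=0$ with colour $b$, for every $0\le j<\ell$, if $\lambda_j$ has colour $c_p$ and $\lambda_{j+1}$ has colour $c_r$, then $\lambda_{j+1}-\lambda_j=|2-p-r|$. Its weight $|\lambda|$ is $\lambda_1+\cdots+\lambda_\ell$. $(x;q)_k=\prod_{j=0}^{k-1}(1-xq^j)$, $(x;q)_0=1$, and similarly for base $q^2$. -}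

module Defs where

open import Data.Nat as ℕ using (ℕ; zero; suc; _<_; ∣_-_∣)
open import Data.Integer as ℤ using (ℤ; +_; -_; _-_)
open import Data.List using (List; []; _∷_)
open import Data.Product using (_×_; _,_; Σ)
open import Data.Unit using (⊤)
open import Data.Bool using (if_then_else_; _∧_)
open import Relation.Binary.PropositionalEquality using (_≡_)

data Colour : Set where
  a b c : Colour

idx : Colour → ℕ
idx a = 0
idx b = 1
idx c = 2

gap : Colour → Colour → ℕ
gap p r = ∣ 2 - (idx p ℕ.+ idx r) ∣

ColouredSeq : Set
ColouredSeq = List (ℕ × Colour)

Chain : ℕ → Colour → ColouredSeq → Set
Chain v p [] = ⊤
Chain v p ((w , r) ∷ l) = (0 < w) × (w ≡ v ℕ.+ gap p r) × Chain w r l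

-- λ ∈ P_{2,b}: λ_0 = 0 with colour b
Grounded : ColouredSeq → Set
Grounded l = Chain 0 b l

weight : ColouredSeq → ℕ
weight [] = 0
weight ((w , _) ∷ l) = w ℕ.+ weight l

isOdd : ℕ → ℕ
isOdd zero = 0
isOdd (suc zero) = 1
isOdd (suc (suc n)) = isOdd n

oddParts : ColouredSeq → ℕ
oddParts [] = 0
oddParts ((w , _) ∷ l) = isOdd w ℕ.+ oddParts l

GP : ℕ → ℕ → Set
GP k N = Σ ColouredSeq (λ l → Grounded l × (oddParts l ≡ k) × (weight l ≡ N))

-- Formal power series in t and q with integer coefficients:
-- s i j is the coefficient of t^i q^j.

Series : Set
Series = ℕ → ℕ → ℤ

sumTo : ℕ → (ℕ → ℤ) → ℤ
sumTo zero f = f 0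
sumTo (suc n) f = sumTo n f ℤ.+ f (suc n)

δ₀ : ℕ → ℕ → ℤ
δ₀ zero zero = + 1
δ₀ _ _ = + 0

nz : ℕ → ℕ → ℤ
nz zero zero = + 0
nz _ _ = + 1

δ : ℕ → ℕ → ℕ → ℕ → ℤ
δ a' b' i j = if (a' ℕ.≡ᵇ i) ∧ (b' ℕ.≡ᵇ j) then + 1 else + 0

one : Series
one = δ₀

mono : ℕ → ℕ → Series
mono a' b' = δ a' b'

_⊕_ : Series → Series → Series
(f ⊕ g) i j = f i j ℤ.+ g i j

_⊗_ : Series → Series → Series
(f ⊗ g) i j = sumTo i (λ a' → sumTo j (λ b' → f a' b' ℤ.* g (i ℕ.∸ a') (j ℕ.∸ b')))

scale : ℤ → Series → Series
scale z f i j = z ℤ.* f i j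

-- Multiplicative inverse of a series f with f 0 0 = 1, computed by the
-- usual recursion g_{ij} = δ_{(i,j),(0,0)} - Σ_{(a,b)≠(0,0)} f_{ab} g_{i-a,j-b};
-- the fuel argument is any bound ≥ i + j.
invAux : ℕ → Series → Series
invAux zero f i j = δ₀ i j
invAux (suc n) f i j =
  δ₀ i j - sumTo i (λ a' → sumTo j (λ b' →
             nz a' b' ℤ.* (f a' b' ℤ.* invAux n f (i ℕ.∸ a') (j ℕ.∸ b'))))

inv : Series → Series
inv f i j = invAux (i ℕ.+ j) f i j

-- (z t^a q^e ; q^2)_n = Π_{j<n} (1 - z t^a q^{e + 2j})
poch : ℤ → ℕ → ℕ → ℕ → Series
poch z a' e zero = one
poch z a' e (suc n) =
  poch z a' e n ⊗ (one ⊕ scale (- z) (mono a' (e ℕ.+ 2 ℕ.* n)))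

-- the n-th summand  t^n q^{n^2} (-1;q^2)_n / ((tq;q^2)_n (q^2;q^2)_n)
rhsTerm : ℕ → Series
rhsTerm n = mono n (n ℕ.* n)
          ⊗ (poch (- + 1) 0 0 n
          ⊗ (inv (poch (+ 1) 1 1 n) ⊗ inv (poch (+ 1) 0 2 n)))

-- Coefficient of t^k q^N in Σ_{n≥0} rhsTerm n.  Since rhsTerm n is divisible
-- by q^{n^2}, only n ≤ N contribute.
rhsCoeff : ℕ → ℕ → ℤ
rhsCoeff k N = sumTo N (λ n → rhsTerm n k N)

-- Sort the parts of a grounded partition into layers, layer j holding its parts 2j+1 (colours a and c) and
-- 2j+2 (colour b).  The gap conditions force: every layer below the largest part contains an odd part; equal odd
-- parts alternate in colour; and the first odd part of layer j+1 keeps the colour of the last odd part of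
-- layer j unless a part 2j+2 separates them.  So a layer is described by its numbers of odd and of even parts
-- and one bit telling whether the colour switches, at the cost of an extra part 2j.  The partitions with n
-- layers are therefore generated by  Π_{j<n} t q^{2j+1} (1 + q^{2j}) / ((1 - t q^{2j+1}) (1 - q^{2j+2})),
-- which is the n-th summand of the right-hand side.  Both sides are compared coefficientwise by showing that
-- each coefficient of the series counts a finite set, a property preserved by sums, products and geometric series.

module Submission where

open import Defs hiding (a; b; c)
open import Data.Bool using (Bool; true; false; not; T)
open import Data.Bool.Properties using (T-≡; ¬-not; ∧-zeroʳ)
open import Data.Empty using (⊥; ⊥-elim)
open import Data.Fin using (Fin)
import Data.Fin.Properties as FinP
open import Data.Integer using (ℤ)
import Data.Integer.Properties as ℤP
open import Data.List using (List; []; _∷_; length)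
open import Data.Nat as ℕ using (ℕ; zero; suc; z≤n; s≤s)
import Data.Nat.Properties as ℕP
open import Data.Nat.Tactic.RingSolver using (solve-∀)
open import Data.Product using (Σ; _×_; _,_; proj₁; proj₂)
open import Data.Product.Function.NonDependent.Propositional using (_×-↔_)
open import Data.Sum using (_⊎_; inj₁; inj₂; [_,_]′)
open import Data.Sum.Function.Propositional using (_⊎-↔_)
open import Data.Unit using (⊤; tt)
open import Function.Bundles using (_↔_; mk↔ₛ′; Inverse; _⇔_; mk⇔; Equivalence)
open import Function.Properties.Inverse using (↔-sym; ↔-trans)
open import Level using (0ℓ)
open import Relation.Binary.Bundles using (Setoid)
open import Relation.Binary.PropositionalEquality
open import Relation.Nullary using (¬_; yes; no)

module PowerSeries where

  open import Data.Integer using (+_; -_; _+_; _*_; _-_)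
  open import Algebra.Properties.CommutativeSemigroup ℤP.+-commutativeSemigroup using (interchange)
  open import Algebra.Properties.AbelianGroup ℤP.+-0-abelianGroup using (//-rightDividesˡ)

  infix 4 _≈_
  _≈_ : Series → Series → Set
  f ≈ g = ∀ i j → f i j ≡ g i j

  ≈-setoid : Setoid 0ℓ 0ℓ
  ≈-setoid = record
    { Carrier = Series
    ; _≈_ = _≈_
    ; isEquivalence = record
      { refl = λ i j → refl
      ; sym = λ p i j → sym (p i j)
      ; trans = λ p q i j → trans (p i j) (q i j)
      }
    }

  open Setoid ≈-setoid public using () renaming (refl to ≈-refl; reflexive to ≈-reflexive; sym to ≈-sym; trans to ≈-trans)

  module ≈-Reasoning where
    open import Relation.Binary.Reasoning.Setoid ≈-setoid public

  sumTo-cong≤ : ∀ n {f g : ℕ → ℤ} → (∀ a → a ℕ.≤ n → f a ≡ g a) → sumTo n f ≡ sumTo n g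
  sumTo-cong≤ zero p = p 0 z≤n
  sumTo-cong≤ (suc n) p = cong₂ _+_ (sumTo-cong≤ n (λ a a≤n → p a (ℕP.m≤n⇒m≤1+n a≤n))) (p (suc n) ℕP.≤-refl)

  sumTo-cong : ∀ n {f g : ℕ → ℤ} → (∀ a → f a ≡ g a) → sumTo n f ≡ sumTo n g
  sumTo-cong n p = sumTo-cong≤ n (λ a _ → p a)

  sumTo-zero : ∀ n {f : ℕ → ℤ} → (∀ a → a ℕ.≤ n → f a ≡ + 0) → sumTo n f ≡ + 0
  sumTo-zero zero p = p 0 z≤n
  sumTo-zero (suc n) p = cong₂ _+_ (sumTo-zero n (λ a a≤n → p a (ℕP.m≤n⇒m≤1+n a≤n))) (p (suc n) ℕP.≤-refl)

  sumTo-+ : ∀ n (f g : ℕ → ℤ) → sumTo n (λ a → f a + g a) ≡ sumTo n f + sumTo n g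
  sumTo-+ zero f g = refl
  sumTo-+ (suc n) f g =
    trans (cong (_+ (f (suc n) + g (suc n))) (sumTo-+ n f g)) (interchange (sumTo n f) (sumTo n g) (f (suc n)) (g (suc n)))

  sumTo-*ˡ : ∀ n z (f : ℕ → ℤ) → z * sumTo n f ≡ sumTo n (λ a → z * f a)
  sumTo-*ˡ zero z f = refl
  sumTo-*ˡ (suc n) z f = trans (ℤP.*-distribˡ-+ z (sumTo n f) (f (suc n))) (cong (_+ (z * f (suc n))) (sumTo-*ˡ n z f))

  sumTo-*ʳ : ∀ n z (f : ℕ → ℤ) → sumTo n f * z ≡ sumTo n (λ a → f a * z)
  sumTo-*ʳ n z f = trans (ℤP.*-comm (sumTo n f) z) (trans (sumTo-*ˡ n z f) (sumTo-cong n (λ a → ℤP.*-comm z (f a))))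

  sumTo-swap : ∀ n m (F : ℕ → ℕ → ℤ) →
               sumTo n (λ a → sumTo m (λ b → F a b)) ≡ sumTo m (λ b → sumTo n (λ a → F a b))
  sumTo-swap zero m F = refl
  sumTo-swap (suc n) m F = begin
    sumTo n (λ a → sumTo m (F a)) + sumTo m (F (suc n))           ≡⟨ cong (_+ sumTo m (F (suc n))) (sumTo-swap n m F) ⟩
    sumTo m (λ b → sumTo n (λ a → F a b)) + sumTo m (F (suc n))   ≡⟨ sym (sumTo-+ m _ _) ⟩
    sumTo m (λ b → sumTo n (λ a → F a b) + F (suc n) b)           ∎
    where open ≡-Reasoning

  sumTo-suc : ∀ n (f : ℕ → ℤ) → sumTo (suc n) f ≡ f 0 + sumTo n (λ a → f (suc a))
  sumTo-suc zero f = refl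
  sumTo-suc (suc n) f = begin
    sumTo (suc n) f + f (suc (suc n))                      ≡⟨ cong (_+ f (suc (suc n))) (sumTo-suc n f) ⟩
    (f 0 + sumTo n (λ a → f (suc a))) + f (suc (suc n))    ≡⟨ ℤP.+-assoc (f 0) _ _ ⟩
    f 0 + (sumTo n (λ a → f (suc a)) + f (suc (suc n)))    ∎
    where open ≡-Reasoning

  sumTo-reverse : ∀ n (f : ℕ → ℤ) → sumTo n f ≡ sumTo n (λ a → f (n ℕ.∸ a))
  sumTo-reverse zero f = refl
  sumTo-reverse (suc n) f = begin
    sumTo n f + f (suc n)                       ≡⟨ ℤP.+-comm (sumTo n f) _ ⟩
    f (suc n) + sumTo n f                       ≡⟨ cong (λ u → f (suc n) + u) (sumTo-reverse n f) ⟩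
    f (suc n) + sumTo n (λ a → f (n ℕ.∸ a))     ≡⟨ sym (sumTo-suc n (λ a → f (suc n ℕ.∸ a))) ⟩
    sumTo (suc n) (λ a → f (suc n ℕ.∸ a))       ∎
    where open ≡-Reasoning

  sumTo-single : ∀ n k (f : ℕ → ℤ) → k ℕ.≤ n → (∀ a → a ≢ k → f a ≡ + 0) → sumTo n f ≡ f k
  sumTo-single zero .zero f z≤n p = refl
  sumTo-single (suc n) k f k≤ p with k ℕP.≟ suc n
  ... | yes refl = trans (cong (_+ f (suc n)) (sumTo-zero n (λ a a≤n → p a (λ eq → ℕP.<-irrefl eq (s≤s a≤n)))))
                         (ℤP.+-identityˡ _)
  ... | no k≢ = trans (cong₂ _+_ (sumTo-single n k f (ℕP.≤-pred (ℕP.≤∧≢⇒< k≤ k≢)) p) (p (suc n) (λ eq → k≢ (sym eq))))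
                      (ℤP.+-identityʳ (f k))

  sumTo-single₀ : ∀ n (f : ℕ → ℤ) → (∀ a → f (suc a) ≡ + 0) → sumTo n f ≡ f 0
  sumTo-single₀ n f p = sumTo-single n 0 f z≤n λ { zero 0≢0 → ⊥-elim (0≢0 refl) ; (suc a) _ → p a }

  sumTo-triangle : ∀ n (F : ℕ → ℕ → ℤ) →
    sumTo n (λ a → sumTo a (λ c → F c a)) ≡ sumTo n (λ c → sumTo (n ℕ.∸ c) (λ e → F c (c ℕ.+ e)))
  sumTo-triangle zero F = refl
  sumTo-triangle (suc n) F = begin
    sumTo n (λ a → sumTo a (λ c → F c a)) + sumTo (suc n) (λ c → F c (suc n))
      ≡⟨ cong (_+ sumTo (suc n) (λ c → F c (suc n))) (sumTo-triangle n F) ⟩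
    R + (sumTo n (λ c → F c (suc n)) + F (suc n) (suc n))
      ≡⟨ sym (ℤP.+-assoc R _ _) ⟩
    (R + sumTo n (λ c → F c (suc n))) + F (suc n) (suc n)
      ≡⟨ cong₂ _+_ (trans (sym (sumTo-+ n _ _)) (sumTo-cong≤ n extend)) diagonal ⟩
    sumTo n (λ c → sumTo (suc n ℕ.∸ c) (λ e → F c (c ℕ.+ e))) + sumTo (suc n ℕ.∸ suc n) (λ e → F (suc n) (suc n ℕ.+ e)) ∎
    where
    open ≡-Reasoning
    R : ℤ
    R = sumTo n (λ c → sumTo (n ℕ.∸ c) (λ e → F c (c ℕ.+ e)))
    diagonal : F (suc n) (suc n) ≡ sumTo (suc n ℕ.∸ suc n) (λ e → F (suc n) (suc n ℕ.+ e))
    diagonal rewrite ℕP.n∸n≡0 n | ℕP.+-identityʳ n = refl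
    extend : ∀ c → c ℕ.≤ n →
             sumTo (n ℕ.∸ c) (λ e → F c (c ℕ.+ e)) + F c (suc n) ≡ sumTo (suc n ℕ.∸ c) (λ e → F c (c ℕ.+ e))
    extend c c≤n rewrite ℕP.+-∸-assoc 1 c≤n =
      cong (λ u → sumTo (n ℕ.∸ c) (λ e → F c (c ℕ.+ e)) + F c u)
           (sym (trans (ℕP.+-suc c (n ℕ.∸ c)) (cong suc (ℕP.m+[n∸m]≡n c≤n))))

  ⊗-cong : ∀ {f f′ g g′} → f ≈ f′ → g ≈ g′ → (f ⊗ g) ≈ (f′ ⊗ g′)
  ⊗-cong p q i j = sumTo-cong i (λ a → sumTo-cong j (λ b → cong₂ _*_ (p a b) (q (i ℕ.∸ a) (j ℕ.∸ b))))

  ⊗-comm : ∀ f g → (f ⊗ g) ≈ (g ⊗ f)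
  ⊗-comm f g i j = begin
    sumTo i (λ a → sumTo j (λ b → f a b * g (i ℕ.∸ a) (j ℕ.∸ b)))
      ≡⟨ sumTo-reverse i _ ⟩
    sumTo i (λ a → sumTo j (λ b → f (i ℕ.∸ a) b * g (i ℕ.∸ (i ℕ.∸ a)) (j ℕ.∸ b)))
      ≡⟨ sumTo-cong i (λ a → sumTo-reverse j _) ⟩
    sumTo i (λ a → sumTo j (λ b → f (i ℕ.∸ a) (j ℕ.∸ b) * g (i ℕ.∸ (i ℕ.∸ a)) (j ℕ.∸ (j ℕ.∸ b))))
      ≡⟨ sumTo-cong≤ i (λ a a≤ → sumTo-cong≤ j (λ b b≤ →
           trans (ℤP.*-comm (f (i ℕ.∸ a) (j ℕ.∸ b)) _)
                 (cong₂ (λ u v → g u v * f (i ℕ.∸ a) (j ℕ.∸ b)) (ℕP.m∸[m∸n]≡n a≤) (ℕP.m∸[m∸n]≡n b≤)))) ⟩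
    sumTo i (λ a → sumTo j (λ b → g a b * f (i ℕ.∸ a) (j ℕ.∸ b))) ∎
    where open ≡-Reasoning

  ⊗-assoc : ∀ f g h → ((f ⊗ g) ⊗ h) ≈ (f ⊗ (g ⊗ h))
  ⊗-assoc f g h i j = begin
    sumTo i (λ a → sumTo j (λ b → sumTo a (λ c → sumTo b (λ d → f c d * g (a ℕ.∸ c) (b ℕ.∸ d))) * h (i ℕ.∸ a) (j ℕ.∸ b)))
      ≡⟨ sumTo-cong i (λ a → sumTo-cong j (λ b → trans (sumTo-*ʳ a _ _) (sumTo-cong a (λ c → sumTo-*ʳ b _ _)))) ⟩
    sumTo i (λ a → sumTo j (λ b → sumTo a (λ c → sumTo b (λ d → X c d a b))))
      ≡⟨ sumTo-cong i (λ a → sumTo-swap j a _) ⟩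
    sumTo i (λ a → sumTo a (λ c → sumTo j (λ b → sumTo b (λ d → X c d a b))))
      ≡⟨ sumTo-triangle i (λ c a → sumTo j (λ b → sumTo b (λ d → X c d a b))) ⟩
    sumTo i (λ c → sumTo (i ℕ.∸ c) (λ e → sumTo j (λ b → sumTo b (λ d → X c d (c ℕ.+ e) b))))
      ≡⟨ sumTo-cong i (λ c → sumTo-cong (i ℕ.∸ c) (λ e → sumTo-triangle j (λ d b → X c d (c ℕ.+ e) b))) ⟩
    sumTo i (λ c → sumTo (i ℕ.∸ c) (λ e → sumTo j (λ d → sumTo (j ℕ.∸ d) (λ e′ → X c d (c ℕ.+ e) (d ℕ.+ e′)))))
      ≡⟨ sumTo-cong i (λ c → sumTo-swap (i ℕ.∸ c) j _) ⟩
    sumTo i (λ c → sumTo j (λ d → sumTo (i ℕ.∸ c) (λ e → sumTo (j ℕ.∸ d) (λ e′ → X c d (c ℕ.+ e) (d ℕ.+ e′)))))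
      ≡⟨ sumTo-cong i (λ c → sumTo-cong j (λ d → trans (sumTo-cong (i ℕ.∸ c) (λ e → sumTo-cong (j ℕ.∸ d) (λ e′ → regroup c d e e′)))
                                                       (sym (factor c d)))) ⟩
    sumTo i (λ c → sumTo j (λ d → f c d * sumTo (i ℕ.∸ c) (λ e → sumTo (j ℕ.∸ d) (λ e′ → g e e′ * h (i ℕ.∸ c ℕ.∸ e) (j ℕ.∸ d ℕ.∸ e′))))) ∎
    where
    open ≡-Reasoning
    X : ℕ → ℕ → ℕ → ℕ → ℤ
    X c d a b = f c d * g (a ℕ.∸ c) (b ℕ.∸ d) * h (i ℕ.∸ a) (j ℕ.∸ b)
    regroup : ∀ c d e e′ → X c d (c ℕ.+ e) (d ℕ.+ e′) ≡ f c d * (g e e′ * h (i ℕ.∸ c ℕ.∸ e) (j ℕ.∸ d ℕ.∸ e′))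
    regroup c d e e′ rewrite ℕP.m+n∸m≡n c e | ℕP.m+n∸m≡n d e′ | ℕP.∸-+-assoc i c e | ℕP.∸-+-assoc j d e′ =
      ℤP.*-assoc (f c d) _ _
    factor : ∀ c d → f c d * sumTo (i ℕ.∸ c) (λ e → sumTo (j ℕ.∸ d) (λ e′ → g e e′ * h (i ℕ.∸ c ℕ.∸ e) (j ℕ.∸ d ℕ.∸ e′)))
                     ≡ sumTo (i ℕ.∸ c) (λ e → sumTo (j ℕ.∸ d) (λ e′ → f c d * (g e e′ * h (i ℕ.∸ c ℕ.∸ e) (j ℕ.∸ d ℕ.∸ e′))))
    factor c d = trans (sumTo-*ˡ (i ℕ.∸ c) (f c d) _) (sumTo-cong (i ℕ.∸ c) (λ e → sumTo-*ˡ (j ℕ.∸ d) (f c d) _))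

  ⊗-identityˡ : ∀ g → (one ⊗ g) ≈ g
  ⊗-identityˡ g i j = begin
    sumTo i (λ a → sumTo j (λ b → δ₀ a b * g (i ℕ.∸ a) (j ℕ.∸ b)))  ≡⟨ sumTo-single₀ i _ (λ a → sumTo-zero j (λ b _ → refl)) ⟩
    sumTo j (λ b → δ₀ 0 b * g i (j ℕ.∸ b))                          ≡⟨ sumTo-single₀ j _ (λ b → refl) ⟩
    + 1 * g i j                                                     ≡⟨ ℤP.*-identityˡ _ ⟩
    g i j                                                           ∎
    where open ≡-Reasoning

  ⊗-identityʳ : ∀ g → (g ⊗ one) ≈ g
  ⊗-identityʳ g = ≈-trans (⊗-comm g one) (⊗-identityˡ g)

  ⊗-distribʳ-⊕ : ∀ f g h → ((f ⊕ g) ⊗ h) ≈ ((f ⊗ h) ⊕ (g ⊗ h))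
  ⊗-distribʳ-⊕ f g h i j =
    trans (sumTo-cong i (λ a → trans (sumTo-cong j (λ b → ℤP.*-distribʳ-+ (h (i ℕ.∸ a) (j ℕ.∸ b)) (f a b) (g a b)))
                                     (sumTo-+ j _ _)))
          (sumTo-+ i _ _)

  ⊗-scaleˡ : ∀ z f g → (scale z f ⊗ g) ≈ scale z (f ⊗ g)
  ⊗-scaleˡ z f g i j =
    sym (trans (sumTo-*ˡ i z _) (sumTo-cong i (λ a → trans (sumTo-*ˡ j z _) (sumTo-cong j (λ b → sym (ℤP.*-assoc z _ _))))))

  ⊗-interchange : ∀ f g h k → ((f ⊗ g) ⊗ (h ⊗ k)) ≈ ((f ⊗ h) ⊗ (g ⊗ k))
  ⊗-interchange f g h k = begin
    (f ⊗ g) ⊗ (h ⊗ k)   ≈⟨ ⊗-assoc f g (h ⊗ k) ⟩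
    f ⊗ (g ⊗ (h ⊗ k))   ≈⟨ ⊗-cong (≈-refl {f}) (≈-sym (⊗-assoc g h k)) ⟩
    f ⊗ ((g ⊗ h) ⊗ k)   ≈⟨ ⊗-cong (≈-refl {f}) (⊗-cong (⊗-comm g h) (≈-refl {k})) ⟩
    f ⊗ ((h ⊗ g) ⊗ k)   ≈⟨ ⊗-cong (≈-refl {f}) (⊗-assoc h g k) ⟩
    f ⊗ (h ⊗ (g ⊗ k))   ≈⟨ ⊗-assoc f h (g ⊗ k) ⟨
    (f ⊗ h) ⊗ (g ⊗ k)   ∎
    where open ≈-Reasoning

  ≡ᵇ-true : ∀ {x u} → x ≡ u → (x ℕ.≡ᵇ u) ≡ true
  ≡ᵇ-true {x} {u} eq = Equivalence.to T-≡ (ℕP.≡⇒≡ᵇ x u eq)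

  ≡ᵇ-false : ∀ {x u} → x ≢ u → (x ℕ.≡ᵇ u) ≡ false
  ≡ᵇ-false {x} {u} x≢u = ¬-not (λ eq → x≢u (ℕP.≡ᵇ⇒≡ x u (subst T (sym eq) tt)))

  δ-≡ : ∀ {x y u v} → x ≡ u → y ≡ v → δ x y u v ≡ + 1
  δ-≡ p q rewrite ≡ᵇ-true p | ≡ᵇ-true q = refl

  δ-≢ˡ : ∀ {x y u v} → x ≢ u → δ x y u v ≡ + 0
  δ-≢ˡ p rewrite ≡ᵇ-false p = refl

  δ-≢ʳ : ∀ {x y u v} → y ≢ v → δ x y u v ≡ + 0
  δ-≢ʳ {x} {u = u} q rewrite ≡ᵇ-false q | ∧-zeroʳ (x ℕ.≡ᵇ u) = refl

  one≈mono₀₀ : one ≈ mono 0 0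
  one≈mono₀₀ zero zero = refl
  one≈mono₀₀ zero (suc j) = refl
  one≈mono₀₀ (suc i) j = refl

  mono-⊗ : ∀ α β g i j → α ℕ.≤ i → β ℕ.≤ j → (mono α β ⊗ g) i j ≡ g (i ℕ.∸ α) (j ℕ.∸ β)
  mono-⊗ α β g i j α≤i β≤j = begin
    sumTo i (λ a → sumTo j (λ b → δ α β a b * g (i ℕ.∸ a) (j ℕ.∸ b)))
      ≡⟨ sumTo-single i α _ α≤i (λ a a≢α → sumTo-zero j (λ b _ →
           cong (_* g (i ℕ.∸ a) (j ℕ.∸ b)) (δ-≢ˡ {α} {β} {a} {b} (≢-sym a≢α)))) ⟩
    sumTo j (λ b → δ α β α b * g (i ℕ.∸ α) (j ℕ.∸ b))
      ≡⟨ sumTo-single j β _ β≤j (λ b b≢β → cong (_* g (i ℕ.∸ α) (j ℕ.∸ b)) (δ-≢ʳ {α} {β} {α} {b} (≢-sym b≢β))) ⟩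
    δ α β α β * g (i ℕ.∸ α) (j ℕ.∸ β)
      ≡⟨ cong (_* g (i ℕ.∸ α) (j ℕ.∸ β)) (δ-≡ {α} {β} {α} {β} refl refl) ⟩
    + 1 * g (i ℕ.∸ α) (j ℕ.∸ β)
      ≡⟨ ℤP.*-identityˡ _ ⟩
    g (i ℕ.∸ α) (j ℕ.∸ β) ∎
    where open ≡-Reasoning

  mono-⊗-<ˡ : ∀ α β g i j → i ℕ.< α → (mono α β ⊗ g) i j ≡ + 0
  mono-⊗-<ˡ α β g i j i<α = sumTo-zero i (λ a a≤i → sumTo-zero j (λ b _ →
    cong (_* g (i ℕ.∸ a) (j ℕ.∸ b)) (δ-≢ˡ {α} {β} {a} {b} (ℕP.>⇒≢ (ℕP.≤-<-trans a≤i i<α)))))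

  mono-⊗-<ʳ : ∀ α β g i j → j ℕ.< β → (mono α β ⊗ g) i j ≡ + 0
  mono-⊗-<ʳ α β g i j j<β = sumTo-zero i (λ a _ → sumTo-zero j (λ b b≤j →
    cong (_* g (i ℕ.∸ a) (j ℕ.∸ b)) (δ-≢ʳ {α} {β} {a} {b} (ℕP.>⇒≢ (ℕP.≤-<-trans b≤j j<β)))))

  δ-cong : ∀ {x y u v x′ y′ u′ v′} → (x ≡ u ⇔ x′ ≡ u′) → (y ≡ v ⇔ y′ ≡ v′) → δ x y u v ≡ δ x′ y′ u′ v′
  δ-cong {x} {y} {u} {v} {x′} {y′} {u′} {v′} p q with x ℕP.≟ u | y ℕP.≟ v
  ... | yes x≡u | yes y≡v =
    trans (δ-≡ {x} {y} {u} {v} x≡u y≡v) (sym (δ-≡ {x′} {y′} {u′} {v′} (Equivalence.to p x≡u) (Equivalence.to q y≡v)))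
  ... | no x≢u  | _       = trans (δ-≢ˡ {x} {y} {u} {v} x≢u) (sym (δ-≢ˡ {x′} {y′} {u′} {v′} (λ e → x≢u (Equivalence.from p e))))
  ... | yes _   | no y≢v  = trans (δ-≢ʳ {x} {y} {u} {v} y≢v) (sym (δ-≢ʳ {x′} {y′} {u′} {v′} (λ e → y≢v (Equivalence.from q e))))

  mono-⊗-mono : ∀ α β γ ε → (mono α β ⊗ mono γ ε) ≈ mono (α ℕ.+ γ) (β ℕ.+ ε)
  mono-⊗-mono α β γ ε i j with α ℕP.≤? i | β ℕP.≤? j
  ... | yes α≤i | yes β≤j = trans (mono-⊗ α β (mono γ ε) i j α≤i β≤j) (δ-cong (∸-≡⇔+-≡ α≤i) (∸-≡⇔+-≡ β≤j))
    where
    ∸-≡⇔+-≡ : ∀ {p q r} → p ℕ.≤ r → (q ≡ r ℕ.∸ p) ⇔ (p ℕ.+ q ≡ r)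
    ∸-≡⇔+-≡ {p} {q} p≤r = mk⇔ (λ e → trans (cong (p ℕ.+_) e) (ℕP.m+[n∸m]≡n p≤r))
                              (λ e → sym (trans (cong (ℕ._∸ p) (sym e)) (ℕP.m+n∸m≡n p q)))
  ... | no α≰i | _ = trans (mono-⊗-<ˡ α β (mono γ ε) i j (ℕP.≰⇒> α≰i))
                          (sym (δ-≢ˡ {α ℕ.+ γ} {β ℕ.+ ε} {i} {j} (λ e → α≰i (subst (α ℕ.≤_) e (ℕP.m≤m+n α γ)))))
  ... | yes _ | no β≰j = trans (mono-⊗-<ʳ α β (mono γ ε) i j (ℕP.≰⇒> β≰j))
                          (sym (δ-≢ʳ {α ℕ.+ γ} {β ℕ.+ ε} {i} {j} (λ e → β≰j (subst (β ℕ.≤_) e (ℕP.m≤m+n β ε)))))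

  correction : Series → Series → ℕ → ℕ → ℤ
  correction f g i j = sumTo i (λ a → sumTo j (λ b → nz a b * (f a b * g (i ℕ.∸ a) (j ℕ.∸ b))))

  ∸+∸<+ : ∀ {a b i j} → a ℕ.≤ i → b ℕ.≤ j → ¬ (a ≡ 0 × b ≡ 0) → (i ℕ.∸ a) ℕ.+ (j ℕ.∸ b) ℕ.< i ℕ.+ j
  ∸+∸<+ {zero} {zero} _ _ nonzero = ⊥-elim (nonzero (refl , refl))
  ∸+∸<+ {suc a} {b} {suc i} {j} (s≤s a≤i) b≤j _ = s≤s (ℕP.+-mono-≤ (ℕP.m∸n≤m i a) (ℕP.m∸n≤m j b))
  ∸+∸<+ {zero} {suc b} {i} {suc j} _ (s≤s b≤j) _ = ℕP.+-monoʳ-< i (s≤s (ℕP.m∸n≤m j b))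

  correction-cong : ∀ f {g h} i j → (∀ i′ j′ → i′ ℕ.+ j′ ℕ.< i ℕ.+ j → g i′ j′ ≡ h i′ j′) →
                    correction f g i j ≡ correction f h i j
  correction-cong f {g} {h} i j g≡h = sumTo-cong≤ i (λ a a≤i → sumTo-cong≤ j (λ b b≤j → term a b a≤i b≤j))
    where
    term : ∀ a b → a ℕ.≤ i → b ℕ.≤ j →
           nz a b * (f a b * g (i ℕ.∸ a) (j ℕ.∸ b)) ≡ nz a b * (f a b * h (i ℕ.∸ a) (j ℕ.∸ b))
    term zero zero _ _ = refl
    term zero (suc b) a≤i b≤j =
      cong (λ u → nz 0 (suc b) * (f 0 (suc b) * u)) (g≡h _ _ (∸+∸<+ a≤i b≤j (λ { (_ , ()) })))
    term (suc a) b a≤i b≤j =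
      cong (λ u → nz (suc a) b * (f (suc a) b * u)) (g≡h _ _ (∸+∸<+ a≤i b≤j (λ { (() , _) })))

  invAux-fuel : ∀ f n m i j → i ℕ.+ j ℕ.≤ n → i ℕ.+ j ℕ.≤ m → invAux n f i j ≡ invAux m f i j
  invAux-fuel f zero    zero    i       j       _  _  = refl
  invAux-fuel f zero    (suc m) zero    zero    _  _  = refl
  invAux-fuel f zero    (suc m) zero    (suc j) () _
  invAux-fuel f zero    (suc m) (suc i) j       () _
  invAux-fuel f (suc n) zero    zero    zero    _  _  = refl
  invAux-fuel f (suc n) zero    zero    (suc j) _  ()
  invAux-fuel f (suc n) zero    (suc i) j       _  ()
  invAux-fuel f (suc n) (suc m) i       j       ≤n ≤m = cong (λ u → δ₀ i j - u) (correction-cong f i j (λ i′ j′ lt →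
    invAux-fuel f n m i′ j′ (ℕP.≤-pred (ℕP.≤-trans lt ≤n)) (ℕP.≤-pred (ℕP.≤-trans lt ≤m))))

  inv-unfold : ∀ f n i j → i ℕ.+ j ≡ suc n → invAux (i ℕ.+ j) f i j ≡ δ₀ i j - correction f (inv f) i j
  inv-unfold f n i j i+j≡1+n rewrite i+j≡1+n = cong (λ u → δ₀ i j - u) (correction-cong f i j (λ i′ j′ lt →
    invAux-fuel f n (i′ ℕ.+ j′) i′ j′ (ℕP.≤-pred (subst (i′ ℕ.+ j′ ℕ.<_) i+j≡1+n lt)) ℕP.≤-refl))

  inv-recursion : ∀ f i j → inv f i j ≡ δ₀ i j - correction f (inv f) i j
  inv-recursion f zero    zero    = refl
  inv-recursion f zero    (suc j) = inv-unfold f j 0 (suc j) refl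
  inv-recursion f (suc i) j       = inv-unfold f (i ℕ.+ j) (suc i) j refl

  sumTo²-split-origin : ∀ i j (T : ℕ → ℕ → ℤ) →
    sumTo i (λ a → sumTo j (λ b → T a b)) ≡ T 0 0 + sumTo i (λ a → sumTo j (λ b → nz a b * T a b))
  sumTo²-split-origin i j T = begin
    sumTo i (λ a → sumTo j (λ b → T a b))
      ≡⟨ sumTo-cong i (λ a → trans (sumTo-cong j (λ b → split a b)) (sumTo-+ j _ _)) ⟩
    sumTo i (λ a → sumTo j (λ b → δ₀ a b * T a b) + sumTo j (λ b → nz a b * T a b))
      ≡⟨ sumTo-+ i _ _ ⟩
    sumTo i (λ a → sumTo j (λ b → δ₀ a b * T a b)) + sumTo i (λ a → sumTo j (λ b → nz a b * T a b))
      ≡⟨ cong (_+ sumTo i (λ a → sumTo j (λ b → nz a b * T a b))) origin ⟩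
    T 0 0 + sumTo i (λ a → sumTo j (λ b → nz a b * T a b)) ∎
    where
    open ≡-Reasoning
    split : ∀ a b → T a b ≡ δ₀ a b * T a b + nz a b * T a b
    split zero    zero    = sym (trans (ℤP.+-identityʳ _) (ℤP.*-identityˡ _))
    split zero    (suc b) = sym (trans (ℤP.+-identityˡ _) (ℤP.*-identityˡ _))
    split (suc a) b       = sym (trans (ℤP.+-identityˡ _) (ℤP.*-identityˡ _))
    origin : sumTo i (λ a → sumTo j (λ b → δ₀ a b * T a b)) ≡ T 0 0
    origin = trans (sumTo-single₀ i _ (λ a → sumTo-zero j (λ b _ → refl)))
                   (trans (sumTo-single₀ j _ (λ b → refl)) (ℤP.*-identityˡ _))

  ⊗-inverseʳ : ∀ f → f 0 0 ≡ + 1 → (f ⊗ inv f) ≈ one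
  ⊗-inverseʳ f f₀₀≡1 i j = begin
    (f ⊗ inv f) i j                                           ≡⟨ sumTo²-split-origin i j _ ⟩
    f 0 0 * inv f i j + correction f (inv f) i j              ≡⟨ cong (λ u → u * inv f i j + correction f (inv f) i j) f₀₀≡1 ⟩
    + 1 * inv f i j + correction f (inv f) i j                ≡⟨ cong (_+ correction f (inv f) i j) (ℤP.*-identityˡ (inv f i j)) ⟩
    inv f i j + correction f (inv f) i j                      ≡⟨ cong (_+ correction f (inv f) i j) (inv-recursion f i j) ⟩
    (δ₀ i j - correction f (inv f) i j) + correction f (inv f) i j  ≡⟨ //-rightDividesˡ _ _ ⟩
    δ₀ i j                                                    ∎
    where open ≡-Reasoning

  inv-unique : ∀ f h → f 0 0 ≡ + 1 → (f ⊗ h) ≈ one → h ≈ inv f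
  inv-unique f h f₀₀≡1 f⊗h≈1 = begin
    h                     ≈⟨ ⊗-identityˡ h ⟨
    one ⊗ h               ≈⟨ ⊗-cong (≈-trans (⊗-comm (inv f) f) (⊗-inverseʳ f f₀₀≡1)) (≈-refl {h}) ⟨
    (inv f ⊗ f) ⊗ h       ≈⟨ ⊗-assoc (inv f) f h ⟩
    inv f ⊗ (f ⊗ h)       ≈⟨ ⊗-cong (≈-refl {inv f}) f⊗h≈1 ⟩
    inv f ⊗ one           ≈⟨ ⊗-identityʳ (inv f) ⟩
    inv f                 ∎
    where open ≈-Reasoning

  inv-⊗ : ∀ f g → f 0 0 ≡ + 1 → g 0 0 ≡ + 1 → inv (f ⊗ g) ≈ (inv f ⊗ inv g)
  inv-⊗ f g f₀₀≡1 g₀₀≡1 = ≈-sym (inv-unique (f ⊗ g) (inv f ⊗ inv g) (cong₂ _*_ f₀₀≡1 g₀₀≡1) (begin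
    (f ⊗ g) ⊗ (inv f ⊗ inv g)   ≈⟨ ⊗-interchange f g (inv f) (inv g) ⟩
    (f ⊗ inv f) ⊗ (g ⊗ inv g)   ≈⟨ ⊗-cong (⊗-inverseʳ f f₀₀≡1) (⊗-inverseʳ g g₀₀≡1) ⟩
    one ⊗ one                   ≈⟨ ⊗-identityˡ one ⟩
    one                         ∎))
    where open ≈-Reasoning

  inv-one : inv one ≈ one
  inv-one = ≈-sym (inv-unique one one refl (⊗-identityˡ one))

  oneMinus : ℕ → ℕ → Series
  oneMinus α β = one ⊕ scale (- + 1) (mono α β)

  oneMinus-origin : ∀ α β → oneMinus α (suc β) 0 0 ≡ + 1
  oneMinus-origin α β = cong (λ u → + 1 + - + 1 * u) (δ-≢ʳ {α} {suc β} {0} {0} (λ ()))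

  inv-oneMinus-recursion : ∀ α β i j →
    inv (oneMinus α (suc β)) i j ≡ δ₀ i j + (mono α (suc β) ⊗ inv (oneMinus α (suc β))) i j
  inv-oneMinus-recursion α β i j = begin
    H i j                ≡⟨ //-rightDividesˡ M (H i j) ⟨
    (H i j - M) + M      ≡⟨ cong (_+ M) H-M≡δ₀ ⟩
    δ₀ i j + M           ∎
    where
    open ≡-Reasoning
    H : Series
    H = inv (oneMinus α (suc β))
    M : ℤ
    M = (mono α (suc β) ⊗ H) i j
    H-M≡δ₀ : H i j - M ≡ δ₀ i j
    H-M≡δ₀ = begin
      H i j - M
        ≡⟨ cong (λ u → H i j + u) (ℤP.-1*i≡-i M) ⟨
      H i j + (- + 1) * M
        ≡⟨ cong₂ _+_ (⊗-identityˡ H i j) (⊗-scaleˡ (- + 1) (mono α (suc β)) H i j) ⟨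
      (one ⊗ H) i j + (scale (- + 1) (mono α (suc β)) ⊗ H) i j
        ≡⟨ ⊗-distribʳ-⊕ one (scale (- + 1) (mono α (suc β))) H i j ⟨
      (oneMinus α (suc β) ⊗ H) i j
        ≡⟨ ⊗-inverseʳ (oneMinus α (suc β)) (oneMinus-origin α β) i j ⟩
      δ₀ i j ∎

  prodTo : (ℕ → Series) → ℕ → Series
  prodTo f zero    = one
  prodTo f (suc n) = prodTo f n ⊗ f n

  prodFrom : (ℕ → Series) → ℕ → ℕ → Series
  prodFrom f j zero    = one
  prodFrom f j (suc n) = f j ⊗ prodFrom f (suc j) n

  prodTo-⊗ : ∀ f g n → (prodTo f n ⊗ prodTo g n) ≈ prodTo (λ k → f k ⊗ g k) n
  prodTo-⊗ f g zero    = ⊗-identityˡ one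
  prodTo-⊗ f g (suc n) =
    ≈-trans (⊗-interchange (prodTo f n) (f n) (prodTo g n) (g n)) (⊗-cong (prodTo-⊗ f g n) (≈-refl {f n ⊗ g n}))

  prodFrom-snoc : ∀ f j n → (prodFrom f j n ⊗ f (j ℕ.+ n)) ≈ prodFrom f j (suc n)
  prodFrom-snoc f j zero rewrite ℕP.+-identityʳ j = ≈-trans (⊗-identityˡ (f j)) (≈-sym (⊗-identityʳ (f j)))
  prodFrom-snoc f j (suc n) rewrite ℕP.+-suc j n =
    ≈-trans (⊗-assoc (f j) (prodFrom f (suc j) n) (f (suc j ℕ.+ n))) (⊗-cong (≈-refl {f j}) (prodFrom-snoc f (suc j) n))

  prodTo≈prodFrom : ∀ f n → prodTo f n ≈ prodFrom f 0 n
  prodTo≈prodFrom f zero    = ≈-refl {one}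
  prodTo≈prodFrom f (suc n) = ≈-trans (⊗-cong (prodTo≈prodFrom f n) (≈-refl {f n})) (prodFrom-snoc f 0 n)

  poch≈prodTo : ∀ z α e n → poch z α e n ≈ prodTo (λ k → one ⊕ scale (- z) (mono α (e ℕ.+ 2 ℕ.* k))) n
  poch≈prodTo z α e zero    = ≈-refl {one}
  poch≈prodTo z α e (suc n) = ⊗-cong (poch≈prodTo z α e n) (≈-refl {one ⊕ scale (- z) (mono α (e ℕ.+ 2 ℕ.* n))})

  poch-origin : ∀ α e n → poch (+ 1) α (suc e) n 0 0 ≡ + 1
  poch-origin α e zero    = refl
  poch-origin α e (suc n) = cong₂ _*_ (poch-origin α e n) (oneMinus-origin α (e ℕ.+ 2 ℕ.* n))

  inv-poch : ∀ α e n → inv (poch (+ 1) α (suc e) n) ≈ prodTo (λ k → inv (oneMinus α (suc e ℕ.+ 2 ℕ.* k))) n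
  inv-poch α e zero    = inv-one
  inv-poch α e (suc n) =
    ≈-trans (inv-⊗ (poch (+ 1) α (suc e) n) (oneMinus α (suc e ℕ.+ 2 ℕ.* n)) (poch-origin α e n) (oneMinus-origin α (e ℕ.+ 2 ℕ.* n)))
            (⊗-cong (inv-poch α e n) (≈-refl {inv (oneMinus α (suc e ℕ.+ 2 ℕ.* n))}))

  mono-square : ∀ n → mono n (n ℕ.* n) ≈ prodTo (λ k → mono 1 (suc (2 ℕ.* k))) n
  mono-square zero    = ≈-sym one≈mono₀₀
  mono-square (suc n) = begin
    mono (suc n) (suc n ℕ.* suc n)                          ≈⟨ ≈-reflexive (cong₂ mono (ℕP.+-comm 1 n) (square-suc n)) ⟩
    mono (n ℕ.+ 1) (n ℕ.* n ℕ.+ suc (2 ℕ.* n))              ≈⟨ mono-⊗-mono n (n ℕ.* n) 1 (suc (2 ℕ.* n)) ⟨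
    mono n (n ℕ.* n) ⊗ mono 1 (suc (2 ℕ.* n))               ≈⟨ ⊗-cong (mono-square n) (≈-refl {mono 1 (suc (2 ℕ.* n))}) ⟩
    prodTo (λ k → mono 1 (suc (2 ℕ.* k))) (suc n)           ∎
    where
    open ≈-Reasoning
    square-suc : ∀ n → suc n ℕ.* suc n ≡ n ℕ.* n ℕ.+ suc (2 ℕ.* n)
    square-suc = solve-∀

module Counting where

  open PowerSeries
  open import Data.Integer using (+_; _+_; _*_)
  open Inverse using (to; from; strictlyInverseˡ; strictlyInverseʳ)

  Fibre : (A : Set) → (A → ℕ) → (A → ℕ) → ℕ → ℕ → Set
  Fibre A s t i j = Σ A (λ x → (s x ≡ i) × (t x ≡ j))

  -- f is the generating function Σ_{x : A} t^{s x} q^{t x}, all of whose fibres are finite.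
  Enumerates : Series → (A : Set) → (A → ℕ) → (A → ℕ) → Set
  Enumerates f A s t = ∀ i j → Σ ℕ (λ m → (f i j ≡ + m) × (Fibre A s t i j ↔ Fin m))

  fibre-≡ : ∀ {A s t i j} {x x′ : A} {p p′} → x ≡ x′ → _≡_ {A = Fibre A s t i j} (x , p) (x′ , p′)
  fibre-≡ {p = p , q} {p′ = p′ , q′} refl = cong₂ (λ u v → _ , u , v) (ℕP.≡-irrelevant p p′) (ℕP.≡-irrelevant q q′)

  fibre-↔ : ∀ {A B s t s′ t′} (e : A ↔ B) → (∀ x → s′ (to e x) ≡ s x) → (∀ x → t′ (to e x) ≡ t x) →
            ∀ i j → Fibre A s t i j ↔ Fibre B s′ t′ i j
  fibre-↔ {A} {B} {s} {t} {s′} {t′} e s′∘e≡s t′∘e≡t i j =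
    mk↔ₛ′ f g (λ { (y , _) → fibre-≡ (strictlyInverseˡ e y) }) (λ { (x , _) → fibre-≡ (strictlyInverseʳ e x) })
    where
    f : Fibre A s t i j → Fibre B s′ t′ i j
    f (x , p , q) = to e x , trans (s′∘e≡s x) p , trans (t′∘e≡t x) q
    g : Fibre B s′ t′ i j → Fibre A s t i j
    g (y , p , q) = from e y , trans (sym (s′∘e≡s (from e y))) (trans (cong s′ (strictlyInverseˡ e y)) p)
                             , trans (sym (t′∘e≡t (from e y))) (trans (cong t′ (strictlyInverseˡ e y)) q)

  enumerates-≈ : ∀ {f g A s t} → f ≈ g → Enumerates f A s t → Enumerates g A s t
  enumerates-≈ f≈g en i j with en i j
  ... | m , fᵢⱼ≡m , fibre↔ = m , trans (sym (f≈g i j)) fᵢⱼ≡m , fibre↔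

  enumerates-↔ : ∀ {f A B s t s′ t′} (e : A ↔ B) → (∀ x → s′ (to e x) ≡ s x) → (∀ x → t′ (to e x) ≡ t x) →
                 Enumerates f A s t → Enumerates f B s′ t′
  enumerates-↔ e s′∘e≡s t′∘e≡t en i j with en i j
  ... | m , fᵢⱼ≡m , fibre↔ = m , fᵢⱼ≡m , ↔-trans (↔-sym (fibre-↔ e s′∘e≡s t′∘e≡t i j)) fibre↔

  enumerates-mono : ∀ α β → Enumerates (mono α β) ⊤ (λ _ → α) (λ _ → β)
  enumerates-mono α β i j with α ℕP.≟ i | β ℕP.≟ j
  ... | yes α≡i | yes β≡j = 1 , δ-≡ {α} {β} {i} {j} α≡i β≡j ,
    ↔-trans (mk↔ₛ′ (λ _ → tt) (λ _ → tt , α≡i , β≡j) (λ _ → refl) (λ _ → fibre-≡ refl)) (↔-sym FinP.1↔⊤)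
  ... | no α≢i  | _       = 0 , δ-≢ˡ {α} {β} {i} {j} α≢i , mk↔ₛ′ (λ { (_ , α≡i , _) → ⊥-elim (α≢i α≡i) }) (λ ()) (λ ())
                                                                    (λ { (_ , α≡i , _) → ⊥-elim (α≢i α≡i) })
  ... | yes _   | no β≢j  = 0 , δ-≢ʳ {α} {β} {i} {j} β≢j , mk↔ₛ′ (λ { (_ , _ , β≡j) → ⊥-elim (β≢j β≡j) }) (λ ()) (λ ())
                                                                    (λ { (_ , _ , β≡j) → ⊥-elim (β≢j β≡j) })

  enumerates-one : Enumerates one ⊤ (λ _ → 0) (λ _ → 0)
  enumerates-one = enumerates-≈ (≈-sym one≈mono₀₀) (enumerates-mono 0 0)

  enumerates-⊕ : ∀ {f g A B s t s′ t′} → Enumerates f A s t → Enumerates g B s′ t′ →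
                 Enumerates (f ⊕ g) (A ⊎ B) [ s , s′ ]′ [ t , t′ ]′
  enumerates-⊕ {A = A} {B} {s} {t} {s′} {t′} enf eng i j with enf i j | eng i j
  ... | m , fᵢⱼ≡m , fibreA↔ | n , gᵢⱼ≡n , fibreB↔ =
    m ℕ.+ n , trans (cong₂ _+_ fᵢⱼ≡m gᵢⱼ≡n) (sym (ℤP.pos-+ m n)) ,
    ↔-trans split (↔-trans (fibreA↔ ⊎-↔ fibreB↔) (↔-sym FinP.+↔⊎))
    where
    split : Fibre (A ⊎ B) [ s , s′ ]′ [ t , t′ ]′ i j ↔ (Fibre A s t i j ⊎ Fibre B s′ t′ i j)
    split = mk↔ₛ′ (λ { (inj₁ x , p) → inj₁ (x , p) ; (inj₂ y , p) → inj₂ (y , p) })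
                  (λ { (inj₁ (x , p)) → inj₁ x , p ; (inj₂ (y , p)) → inj₂ y , p })
                  (λ { (inj₁ _) → refl ; (inj₂ _) → refl })
                  (λ { (inj₁ _ , _) → refl ; (inj₂ _ , _) → refl })

  sumℕ : ℕ → (ℕ → ℕ) → ℕ
  sumℕ zero    F = F 0
  sumℕ (suc n) F = sumℕ n F ℕ.+ F (suc n)

  sumTo-pos : ∀ n F → sumTo n (λ a → + F a) ≡ + sumℕ n F
  sumTo-pos zero    F = refl
  sumTo-pos (suc n) F = trans (cong (_+ + F (suc n)) (sumTo-pos n F)) (sym (ℤP.pos-+ (sumℕ n F) (F (suc n))))

  Σ≤ : ℕ → (ℕ → Set) → Set
  Σ≤ n P = Σ ℕ (λ a → a ℕ.≤ n × P a)

  Σ≤-zero : ∀ {P} → Σ≤ 0 P ↔ P 0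
  Σ≤-zero = mk↔ₛ′ (λ { (zero , z≤n , x) → x }) (λ x → 0 , z≤n , x) (λ _ → refl) (λ { (zero , z≤n , x) → refl })

  Σ≤-suc : ∀ n {P} → Σ≤ (suc n) P ↔ (Σ≤ n P ⊎ P (suc n))
  Σ≤-suc n {P} = mk↔ₛ′ split join split∘join join∘split
    where
    split-by : ∀ a → P a → a ℕ.< suc n ⊎ a ≡ suc n → Σ≤ n P ⊎ P (suc n)
    split-by a x (inj₁ a<1+n) = inj₁ (a , ℕP.≤-pred a<1+n , x)
    split-by a x (inj₂ refl)  = inj₂ x
    split : Σ≤ (suc n) P → Σ≤ n P ⊎ P (suc n)
    split (a , a≤1+n , x) = split-by a x (ℕP.m≤n⇒m<n∨m≡n a≤1+n)
    join : Σ≤ n P ⊎ P (suc n) → Σ≤ (suc n) P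
    join (inj₁ (a , a≤n , x)) = a , ℕP.m≤n⇒m≤1+n a≤n , x
    join (inj₂ x)             = suc n , ℕP.≤-refl , x
    split∘join : ∀ y → split (join y) ≡ y
    split∘join (inj₁ (a , a≤n , x)) with ℕP.m≤n⇒m<n∨m≡n (ℕP.m≤n⇒m≤1+n a≤n)
    ... | inj₁ a<1+n = cong (λ le → inj₁ (a , le , x)) (ℕP.≤-irrelevant _ _)
    ... | inj₂ refl  = ⊥-elim (ℕP.<-irrefl refl a≤n)
    split∘join (inj₂ x) with ℕP.m≤n⇒m<n∨m≡n (ℕP.≤-refl {suc n})
    ... | inj₁ n<n  = ⊥-elim (ℕP.<-irrefl refl n<n)
    ... | inj₂ refl = refl
    join∘split : ∀ z → join (split z) ≡ z
    join∘split (a , a≤1+n , x) with ℕP.m≤n⇒m<n∨m≡n a≤1+n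
    ... | inj₁ a<1+n = cong (λ le → a , le , x) (ℕP.≤-irrelevant _ _)
    ... | inj₂ refl  = cong (λ le → a , le , x) (ℕP.≤-irrelevant _ _)

  Σ≤-Fin : ∀ n {P : ℕ → Set} {F} → (∀ a → P a ↔ Fin (F a)) → Σ≤ n P ↔ Fin (sumℕ n F)
  Σ≤-Fin zero    P↔Fin = ↔-trans Σ≤-zero (P↔Fin 0)
  Σ≤-Fin (suc n) P↔Fin = ↔-trans (Σ≤-suc n) (↔-trans (Σ≤-Fin n P↔Fin ⊎-↔ P↔Fin (suc n)) (↔-sym FinP.+↔⊎))

  infixl 6 _⊹_
  _⊹_ : ∀ {A B : Set} → (A → ℕ) → (B → ℕ) → A × B → ℕ
  (s ⊹ s′) (x , y) = s x ℕ.+ s′ y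

  module _ {A B : Set} (s t : A → ℕ) (s′ t′ : B → ℕ) (i j : ℕ) where

    ConvolutionFibre : Set
    ConvolutionFibre = Σ≤ i (λ a → Σ≤ j (λ b → Fibre A s t a b × Fibre B s′ t′ (i ℕ.∸ a) (j ℕ.∸ b)))

    fibre-×↔ : Fibre (A × B) (s ⊹ s′) (t ⊹ t′) i j ↔ ConvolutionFibre
    fibre-×↔ = mk↔ₛ′ split join split∘join (λ _ → fibre-≡ refl)
      where
      split : Fibre (A × B) (s ⊹ s′) (t ⊹ t′) i j → ConvolutionFibre
      split ((x , y) , p , q) =
        s x , subst (s x ℕ.≤_) p (ℕP.m≤m+n (s x) (s′ y)) ,
        t x , subst (t x ℕ.≤_) q (ℕP.m≤m+n (t x) (t′ y)) ,
        (x , refl , refl) ,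
        (y , sym (trans (cong (ℕ._∸ s x) (sym p)) (ℕP.m+n∸m≡n (s x) (s′ y))) ,
             sym (trans (cong (ℕ._∸ t x) (sym q)) (ℕP.m+n∸m≡n (t x) (t′ y))))
      join : ConvolutionFibre → Fibre (A × B) (s ⊹ s′) (t ⊹ t′) i j
      join (a , a≤i , b , b≤j , (x , sx≡a , tx≡b) , (y , s′y≡ , t′y≡)) =
        (x , y) , trans (cong₂ ℕ._+_ sx≡a s′y≡) (ℕP.m+[n∸m]≡n a≤i) , trans (cong₂ ℕ._+_ tx≡b t′y≡) (ℕP.m+[n∸m]≡n b≤j)
      split∘join : ∀ z → split (join z) ≡ z
      split∘join (_ , _ , _ , _ , (x , refl , refl) , _) = cong-indices (fibre-≡ refl)
        where
        cong-indices : ∀ {a≤i a≤i′ b≤j b≤j′} {y y′ : Fibre B s′ t′ (i ℕ.∸ s x) (j ℕ.∸ t x)} → y ≡ y′ →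
                       _≡_ {A = ConvolutionFibre}
                           (s x , a≤i , t x , b≤j , (x , refl , refl) , y) (s x , a≤i′ , t x , b≤j′ , (x , refl , refl) , y′)
        cong-indices {a≤i} {a≤i′} {b≤j} {b≤j′} refl =
          cong₂ (λ u v → s x , u , t x , v , (x , refl , refl) , _) (ℕP.≤-irrelevant a≤i a≤i′) (ℕP.≤-irrelevant b≤j b≤j′)

  enumerates-⊗ : ∀ {f g A B s t s′ t′} → Enumerates f A s t → Enumerates g B s′ t′ →
                 Enumerates (f ⊗ g) (A × B) (s ⊹ s′) (t ⊹ t′)
  enumerates-⊗ {f} {g} {A} {B} {s} {t} {s′} {t′} enf eng i j =
    sumℕ i (λ a → sumℕ j (λ b → M a b ℕ.* N a b)) , coefficient ,
    ↔-trans (fibre-×↔ s t s′ t′ i j) (Σ≤-Fin i (λ a → Σ≤-Fin j (λ b → pair↔ a b)))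
    where
    M N : ℕ → ℕ → ℕ
    M a b = proj₁ (enf a b)
    N a b = proj₁ (eng (i ℕ.∸ a) (j ℕ.∸ b))
    coefficient : (f ⊗ g) i j ≡ + sumℕ i (λ a → sumℕ j (λ b → M a b ℕ.* N a b))
    coefficient = trans (sumTo-cong i (λ a → trans (sumTo-cong j (λ b →
                    trans (cong₂ _*_ (proj₁ (proj₂ (enf a b))) (proj₁ (proj₂ (eng (i ℕ.∸ a) (j ℕ.∸ b)))))
                          (sym (ℤP.pos-* (M a b) (N a b)))))
                    (sumTo-pos j (λ b → M a b ℕ.* N a b))))
                  (sumTo-pos i (λ a → sumℕ j (λ b → M a b ℕ.* N a b)))
    pair↔ : ∀ a b → (Fibre A s t a b × Fibre B s′ t′ (i ℕ.∸ a) (j ℕ.∸ b)) ↔ Fin (M a b ℕ.* N a b)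
    pair↔ a b = ↔-trans (proj₂ (proj₂ (enf a b)) ×-↔ proj₂ (proj₂ (eng (i ℕ.∸ a) (j ℕ.∸ b)))) (↔-sym FinP.*↔×)

  module _ (α β : ℕ) where

    private
      H : Series
      H = inv (oneMinus α (suc β))
      Multiples : ℕ → ℕ → Set
      Multiples = Fibre ℕ (ℕ._* α) (ℕ._* suc β)

    multiples-pred↔ : ∀ i j → α ℕ.≤ i → suc β ℕ.≤ j → Multiples i j ↔ Multiples (i ℕ.∸ α) (j ℕ.∸ suc β)
    multiples-pred↔ i j α≤i 1+β≤j = mk↔ₛ′ pred succ (λ _ → fibre-≡ refl) succ∘pred
      where
      pred : Multiples i j → Multiples (i ℕ.∸ α) (j ℕ.∸ suc β)
      pred (zero  , _ , refl) = ⊥-elim (ℕP.n≮0 1+β≤j)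
      pred (suc m , p , q)    = m , sym (trans (cong (ℕ._∸ α) (sym p)) (ℕP.m+n∸m≡n α (m ℕ.* α)))
                                  , sym (trans (cong (ℕ._∸ suc β) (sym q)) (ℕP.m+n∸m≡n (suc β) (m ℕ.* suc β)))
      succ : Multiples (i ℕ.∸ α) (j ℕ.∸ suc β) → Multiples i j
      succ (m , p , q) = suc m , trans (cong (α ℕ.+_) p) (ℕP.m+[n∸m]≡n α≤i)
                               , trans (cong (suc β ℕ.+_) q) (ℕP.m+[n∸m]≡n 1+β≤j)
      succ∘pred : ∀ z → succ (pred z) ≡ z
      succ∘pred (zero  , _ , refl) = ⊥-elim (ℕP.n≮0 1+β≤j)
      succ∘pred (suc m , p , q)    = fibre-≡ refl

    multiples-zero↔ : ∀ i j → ¬ (α ℕ.≤ i × suc β ℕ.≤ j) → Multiples i j ↔ Fibre ⊤ (λ _ → 0) (λ _ → 0) i j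
    multiples-zero↔ i j out = mk↔ₛ′ to-zero (λ { (tt , p , q) → zero , p , q }) (λ _ → fibre-≡ refl) from∘to
      where
      no-successor : ∀ m → suc m ℕ.* α ≡ i → suc m ℕ.* suc β ≡ j → ⊥
      no-successor m p q = out (subst (α ℕ.≤_) p (ℕP.m≤m+n α (m ℕ.* α)) , subst (suc β ℕ.≤_) q (ℕP.m≤m+n (suc β) (m ℕ.* suc β)))
      to-zero : Multiples i j → Fibre ⊤ (λ _ → 0) (λ _ → 0) i j
      to-zero (zero  , p , q) = tt , p , q
      to-zero (suc m , p , q) = ⊥-elim (no-successor m p q)
      from∘to : ∀ z → (zero , proj₂ (to-zero z)) ≡ z
      from∘to (zero  , p , q) = refl
      from∘to (suc m , p , q) = ⊥-elim (no-successor m p q)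

    -- Induction on the q-degree, which drops by 1 + β at each step of H = 1 + t^α q^{1+β} H.
    enumerates-inv-oneMinus : Enumerates H ℕ (ℕ._* α) (ℕ._* suc β)
    enumerates-inv-oneMinus i j = below (suc j) i j ℕP.≤-refl
      where
      below-origin : ∀ i j → (mono α (suc β) ⊗ H) i j ≡ + 0 → ¬ (α ℕ.≤ i × suc β ℕ.≤ j) →
                     Σ ℕ (λ m → (H i j ≡ + m) × (Multiples i j ↔ Fin m))
      below-origin i j shifted≡0 out with enumerates-one i j
      ... | m , oneᵢⱼ≡m , one↔ =
        m , trans (inv-oneMinus-recursion α β i j)
                  (trans (cong (λ u → δ₀ i j + u) shifted≡0) (trans (ℤP.+-identityʳ (δ₀ i j)) oneᵢⱼ≡m)) ,
        ↔-trans (multiples-zero↔ i j out) one↔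

      below : ∀ d i j → j ℕ.< d → Σ ℕ (λ m → (H i j ≡ + m) × (Multiples i j ↔ Fin m))
      below (suc d) i j j<d with α ℕP.≤? i | suc β ℕP.≤? j
      below (suc d) i (suc j) j<d | yes α≤i | yes 1+β≤j@(s≤s β≤j)
        with below d (i ℕ.∸ α) (j ℕ.∸ β) (ℕP.≤-<-trans (ℕP.m∸n≤m j β) (ℕP.≤-pred j<d))
      ... | m , shifted≡m , multiples↔ =
        m , trans (inv-oneMinus-recursion α β i (suc j))
                  (trans (cong₂ _+_ (δ₀-suc i j) (trans (mono-⊗ α (suc β) H i (suc j) α≤i 1+β≤j) shifted≡m)) (ℤP.+-identityˡ (+ m))) ,
        ↔-trans (multiples-pred↔ i (suc j) α≤i 1+β≤j) multiples↔
        where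
        δ₀-suc : ∀ i j → δ₀ i (suc j) ≡ + 0
        δ₀-suc zero    j = refl
        δ₀-suc (suc i) j = refl
      below (suc d) i j j<d | no α≰i | _ =
        below-origin i j (mono-⊗-<ˡ α (suc β) H i j (ℕP.≰⇒> α≰i)) (λ (α≤i , _) → α≰i α≤i)
      below (suc d) i j j<d | yes _ | no 1+β≰j =
        below-origin i j (mono-⊗-<ʳ α (suc β) H i j (ℕP.≰⇒> 1+β≰j)) (λ (_ , 1+β≤j) → 1+β≰j 1+β≤j)

  -- The degree bound makes the truncated sum sumTo j the full coefficient of q^j.
  enumerates-Σ : ∀ {f : ℕ → Series} {A : ℕ → Set} {s t : ∀ n → A n → ℕ} →
                 (∀ n → Enumerates (f n) (A n) (s n) (t n)) → (∀ n x → n ℕ.≤ t n x) →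
                 Enumerates (λ i j → sumTo j (λ n → f n i j)) (Σ ℕ A) (λ (n , x) → s n x) (λ (n , x) → t n x)
  enumerates-Σ {f} {A} {s} {t} en n≤t i j =
    sumℕ j M , trans (sumTo-cong j (λ n → proj₁ (proj₂ (en n i j)))) (sumTo-pos j M) ,
    ↔-trans bounded (Σ≤-Fin j (λ n → proj₂ (proj₂ (en n i j))))
    where
    M : ℕ → ℕ
    M n = proj₁ (en n i j)
    bounded : Fibre (Σ ℕ A) (λ (n , x) → s n x) (λ (n , x) → t n x) i j ↔ Σ≤ j (λ n → Fibre (A n) (s n) (t n) i j)
    bounded = mk↔ₛ′ (λ ((n , x) , p , q) → n , subst (n ℕ.≤_) q (n≤t n x) , x , p , q)
                    (λ (n , _ , x , p , q) → (n , x) , p , q)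
                    (λ (n , _ , z) → cong (λ le → n , le , z) (ℕP.≤-irrelevant _ _))
                    (λ _ → refl)

module Layers where

  open import Data.Nat using (_+_; _*_)
  open Counting using (_⊹_)

  -- The layer (s , x , y) at level j has 1 + x odd parts 2j+1 and y even parts 2j+2; s records whether its odd
  -- colour differs from that of layer j-1, which costs an extra part 2j (at level 0, s is the colour of the part 1).
  Layer : Set
  Layer = Bool × ℕ × ℕ

  odd even : ℕ → ℕ
  odd  j = suc (2 * j)
  even j = suc (suc (2 * j))

  switchCost : ℕ → Bool → ℕ
  switchCost j false = 0
  switchCost j true  = 2 * j

  layerOdd : Layer → ℕ
  layerOdd (_ , x , _) = suc x

  layerWeight : ℕ → Layer → ℕ
  layerWeight j (s , x , y) = suc x * odd j + y * even j + switchCost j s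

  layersOdd : List Layer → ℕ
  layersOdd []       = 0
  layersOdd (l ∷ ls) = layerOdd l + layersOdd ls

  layersWeight : ℕ → List Layer → ℕ
  layersWeight j []       = 0
  layersWeight j (l ∷ ls) = layerWeight j l + layersWeight (suc j) ls

  Layers : ℕ → Set
  Layers zero    = ⊤
  Layers (suc n) = Layer × Layers n

  layersOddᵛ : ∀ n → Layers n → ℕ
  layersOddᵛ zero    = λ _ → 0
  layersOddᵛ (suc n) = layerOdd ⊹ layersOddᵛ n

  layersWeightᵛ : ℕ → ∀ n → Layers n → ℕ
  layersWeightᵛ j zero    = λ _ → 0
  layersWeightᵛ j (suc n) = layerWeight j ⊹ layersWeightᵛ (suc j) n

  toList : ∀ n → Layers n → List Layer
  toList zero    _        = []
  toList (suc n) (l , ls) = l ∷ toList n ls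

  fromList : (ls : List Layer) → Layers (length ls)
  fromList []       = tt
  fromList (l ∷ ls) = l , fromList ls

  Σlayers↔list : Σ ℕ Layers ↔ List Layer
  Σlayers↔list = mk↔ₛ′ (λ (n , ls) → toList n ls) (λ ls → length ls , fromList ls) to∘from (λ (n , ls) → from∘to n ls)
    where
    to∘from : ∀ ls → toList (length ls) (fromList ls) ≡ ls
    to∘from []       = refl
    to∘from (l ∷ ls) = cong (l ∷_) (to∘from ls)
    from∘to : ∀ n ls → _≡_ {A = Σ ℕ Layers} (length (toList n ls) , fromList (toList n ls)) (n , ls)
    from∘to zero    tt       = refl
    from∘to (suc n) (l , ls) = cong (λ (m , ls′) → suc m , l , ls′) (from∘to n ls)

  layersOdd-toList : ∀ n ls → layersOdd (toList n ls) ≡ layersOddᵛ n ls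
  layersOdd-toList zero    _        = refl
  layersOdd-toList (suc n) (l , ls) = cong (λ m → layerOdd l + m) (layersOdd-toList n ls)

  layersWeight-toList : ∀ j n ls → layersWeight j (toList n ls) ≡ layersWeightᵛ j n ls
  layersWeight-toList j zero    _        = refl
  layersWeight-toList j (suc n) (l , ls) = cong (λ m → layerWeight j l + m) (layersWeight-toList (suc j) n ls)

  -- Each layer contains a part 2j+1.
  n≤layersWeightᵛ : ∀ j n ls → n ℕ.≤ layersWeightᵛ j n ls
  n≤layersWeightᵛ j zero    _        = z≤n
  n≤layersWeightᵛ j (suc n) (l , ls) = s≤s (ℕP.≤-trans (n≤layersWeightᵛ (suc j) n ls) (ℕP.m≤n+m _ _))

module RightHandSide where

  open PowerSeries
  open Counting
  open Layers
  open import Data.Integer using (+_; -_)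
  open import Data.Nat using (_+_; _*_)

  layerFactor : ℕ → Series
  layerFactor j = mono 1 (odd j) ⊗ ((one ⊕ scale (+ 1) (mono 0 (2 * j))) ⊗ (inv (oneMinus 1 (odd j)) ⊗ inv (oneMinus 0 (even j))))

  rhsTerm≈prodFrom : ∀ n → rhsTerm n ≈ prodFrom layerFactor 0 n
  rhsTerm≈prodFrom n = begin
    rhsTerm n
      ≈⟨ ⊗-cong (mono-square n) (⊗-cong (poch≈prodTo (- + 1) 0 0 n) (⊗-cong (inv-poch 1 0 n) (inv-poch 0 1 n))) ⟩
    prodTo M n ⊗ (prodTo A n ⊗ (prodTo G n ⊗ prodTo K n))
      ≈⟨ ⊗-cong (≈-refl {prodTo M n}) (⊗-cong (≈-refl {prodTo A n}) (prodTo-⊗ G K n)) ⟩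
    prodTo M n ⊗ (prodTo A n ⊗ prodTo (λ k → G k ⊗ K k) n)
      ≈⟨ ⊗-cong (≈-refl {prodTo M n}) (prodTo-⊗ A (λ k → G k ⊗ K k) n) ⟩
    prodTo M n ⊗ prodTo (λ k → A k ⊗ (G k ⊗ K k)) n
      ≈⟨ prodTo-⊗ M (λ k → A k ⊗ (G k ⊗ K k)) n ⟩
    prodTo layerFactor n
      ≈⟨ prodTo≈prodFrom layerFactor n ⟩
    prodFrom layerFactor 0 n ∎
    where
    open ≈-Reasoning
    M A G K : ℕ → Series
    M k = mono 1 (odd k)
    A k = one ⊕ scale (+ 1) (mono 0 (2 * k))
    G k = inv (oneMinus 1 (odd k))
    K k = inv (oneMinus 0 (even k))

  private
    oddCount : ∀ x y → suc x ≡ 1 + (0 + (x * 1 + y * 0))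
    oddCount = solve-∀
    rearrange : ∀ o e x y s → suc x * o + y * e + s ≡ o + (s + (x * o + y * e))
    rearrange = solve-∀

  enumerates-layerFactor : ∀ j → Enumerates (layerFactor j) Layer layerOdd (layerWeight j)
  enumerates-layerFactor j =
    enumerates-↔ layer↔ odd≡ weight≡
      (enumerates-⊗ (enumerates-mono 1 (odd j))
        (enumerates-⊗ (enumerates-⊕ enumerates-one (enumerates-≈ (λ i j → sym (ℤP.*-identityˡ _)) (enumerates-mono 0 (2 * j))))
          (enumerates-⊗ (enumerates-inv-oneMinus 1 (2 * j)) (enumerates-inv-oneMinus 0 (suc (2 * j))))))
    where
    Choices : Set
    Choices = ⊤ × ((⊤ ⊎ ⊤) × (ℕ × ℕ))
    layer↔ : Choices ↔ Layer
    layer↔ = mk↔ₛ′ (λ { (_ , inj₁ _ , xy) → false , xy ; (_ , inj₂ _ , xy) → true , xy })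
                   (λ { (false , xy) → tt , inj₁ tt , xy ; (true , xy) → tt , inj₂ tt , xy })
                   (λ { (false , _) → refl ; (true , _) → refl })
                   (λ { (_ , inj₁ _ , _) → refl ; (_ , inj₂ _ , _) → refl })
    odd≡ : ∀ z → layerOdd (Inverse.to layer↔ z) ≡ ((λ _ → 1) ⊹ ([ (λ _ → 0) , (λ _ → 0) ]′ ⊹ ((_* 1) ⊹ (_* 0)))) z
    odd≡ (_ , inj₁ _ , x , y) = oddCount x y
    odd≡ (_ , inj₂ _ , x , y) = oddCount x y
    weight≡ : ∀ z → layerWeight j (Inverse.to layer↔ z) ≡
                    ((λ _ → odd j) ⊹ ([ (λ _ → 0) , (λ _ → 2 * j) ]′ ⊹ ((_* odd j) ⊹ (_* even j)))) z
    weight≡ (_ , inj₁ _ , x , y) = rearrange (odd j) (even j) x y 0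
    weight≡ (_ , inj₂ _ , x , y) = rearrange (odd j) (even j) x y (2 * j)

  enumerates-prodFrom : ∀ j n → Enumerates (prodFrom layerFactor j n) (Layers n) (layersOddᵛ n) (layersWeightᵛ j n)
  enumerates-prodFrom j zero    = enumerates-one
  enumerates-prodFrom j (suc n) = enumerates-⊗ (enumerates-layerFactor j) (enumerates-prodFrom (suc j) n)

  enumerates-rhsTerm : ∀ n → Enumerates (rhsTerm n) (Layers n) (layersOddᵛ n) (layersWeightᵛ 0 n)
  enumerates-rhsTerm n = enumerates-≈ (≈-sym (rhsTerm≈prodFrom n)) (enumerates-prodFrom 0 n)

module GroundedPartitions where

  open Defs using (a; b; c)
  open Layers
  open Counting using (Fibre)
  open import Data.Nat using (_+_; _*_)
  open import Data.Product using (map₁)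

  oddColour : Bool → Colour
  oddColour false = a
  oddColour true  = c

  -- The colour of a part relative to the colour d of the preceding odd part.
  data Step (d : Bool) : Colour → Set where
    same   : Step d (oddColour d)
    switch : Step d (oddColour (not d))
    middle : Step d b

  step : ∀ d r → Step d r
  step false a = same
  step false b = middle
  step false c = switch
  step true  a = switch
  step true  b = middle
  step true  c = same

  step-same : ∀ d → step d (oddColour d) ≡ same
  step-same false = refl
  step-same true  = refl

  step-switch : ∀ d → step d (oddColour (not d)) ≡ switch
  step-switch false = refl
  step-switch true  = refl

  step-middle : ∀ d → step d b ≡ middle
  step-middle false = refl
  step-middle true  = refl

  odd-suc : ∀ j → odd (suc j) ≡ odd j + 2
  odd-suc j = trans (cong suc (ℕP.*-suc 2 j)) (ℕP.+-comm 2 (odd j))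

  odd-suc-even : ∀ j → odd (suc j) ≡ even j + 1
  odd-suc-even j = trans (cong suc (ℕP.*-suc 2 j)) (ℕP.+-comm 1 (even j))

  even-odd : ∀ j → even j ≡ odd j + 1
  even-odd j = ℕP.+-comm 1 (odd j)

  gap-same : ∀ j d → odd (suc j) ≡ odd j + gap (oddColour d) (oddColour d)
  gap-same j false = odd-suc j
  gap-same j true  = odd-suc j

  gap-switch : ∀ j d → odd j ≡ odd j + gap (oddColour d) (oddColour (not d))
  gap-switch j false = sym (ℕP.+-identityʳ (odd j))
  gap-switch j true  = sym (ℕP.+-identityʳ (odd j))

  gap-odd-even : ∀ j d → even j ≡ odd j + gap (oddColour d) b
  gap-odd-even j false = even-odd j
  gap-odd-even j true  = even-odd j

  gap-even-even : ∀ j → even j ≡ even j + gap b b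
  gap-even-even j = sym (ℕP.+-identityʳ (even j))

  gap-even-odd : ∀ j d → odd (suc j) ≡ even j + gap b (oddColour d)
  gap-even-odd j false = odd-suc-even j
  gap-even-odd j true  = odd-suc-even j

  gap-ground : ∀ d → 1 ≡ 0 + gap b (oddColour d)
  gap-ground false = refl
  gap-ground true  = refl

  -- decodeOdd j d x y ls continues after an odd part 2j+1 of colour d with x more odd parts 2j+1
  -- (necessarily alternating in colour), then y even parts 2j+2, then the layers ls from level j+1 on.
  mutual
    decodeOdd : ℕ → Bool → ℕ → ℕ → List Layer → ColouredSeq
    decodeOdd j d zero    y ls = decodeEven j d y ls
    decodeOdd j d (suc x) y ls = (odd j , oddColour (not d)) ∷ decodeOdd j (not d) x y ls

    decodeEven : ℕ → Bool → ℕ → List Layer → ColouredSeq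
    decodeEven j d (suc y) ls                 = (even j , b) ∷ decodeEven j d y ls
    decodeEven j d zero    []                 = []
    decodeEven j d zero    ((s , x , y) ∷ ls) = decodeLayer j d s x y ls

    decodeLayer : ℕ → Bool → Bool → ℕ → ℕ → List Layer → ColouredSeq
    decodeLayer j d false x y ls = (odd (suc j) , oddColour d) ∷ decodeOdd (suc j) d x y ls
    decodeLayer j d true  x y ls = (even j , b) ∷ (odd (suc j) , oddColour (not d)) ∷ decodeOdd (suc j) (not d) x y ls

  decode : List Layer → ColouredSeq
  decode []                 = []
  decode ((s , x , y) ∷ ls) = (1 , oddColour s) ∷ decodeOdd 0 s x y ls

  consLayer : Bool → ℕ × ℕ × List Layer → List Layer
  consLayer s (x , y , ls) = (s , x , y) ∷ ls

  mutual
    parseOdd : Bool → ColouredSeq → ℕ × ℕ × List Layer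
    parseOdd d []            = 0 , 0 , []
    parseOdd d ((_ , r) ∷ l) = parseOddStep d l (step d r)

    parseOddStep : ∀ d {r} → ColouredSeq → Step d r → ℕ × ℕ × List Layer
    parseOddStep d l same   = 0 , 0 , consLayer false (parseOdd d l)
    parseOddStep d l switch = map₁ suc (parseOdd (not d) l)
    parseOddStep d l middle = 0 , parseEven d l

    parseEven : Bool → ColouredSeq → ℕ × List Layer
    parseEven d []            = 1 , []
    parseEven d ((_ , r) ∷ l) = parseEvenStep d l (step d r)

    parseEvenStep : ∀ d {r} → ColouredSeq → Step d r → ℕ × List Layer
    parseEvenStep d l same   = 1 , consLayer false (parseOdd d l)
    parseEvenStep d l switch = 0 , consLayer true (parseOdd (not d) l)
    parseEvenStep d l middle = map₁ suc (parseEven d l)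

  parse : ColouredSeq → List Layer
  parse []            = []
  parse ((_ , a) ∷ l) = consLayer false (parseOdd false l)
  parse ((_ , b) ∷ l) = []
  parse ((_ , c) ∷ l) = consLayer true (parseOdd true l)

  mutual
    decodeOdd-chain : ∀ j d x y ls → Chain (odd j) (oddColour d) (decodeOdd j d x y ls)
    decodeOdd-chain j d zero    y ls = decodeEven-chainᵒ j d y ls
    decodeOdd-chain j d (suc x) y ls = ℕ.z<s , gap-switch j d , decodeOdd-chain j (not d) x y ls

    decodeEven-chainᵒ : ∀ j d y ls → Chain (odd j) (oddColour d) (decodeEven j d y ls)
    decodeEven-chainᵒ j d (suc y) ls                 = ℕ.z<s , gap-odd-even j d , decodeEven-chainᵉ j d y ls
    decodeEven-chainᵒ j d zero    []                 = tt
    decodeEven-chainᵒ j d zero    ((s , x , y) ∷ ls) = decodeLayer-chainᵒ j d s x y ls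

    decodeEven-chainᵉ : ∀ j d y ls → Chain (even j) b (decodeEven j d y ls)
    decodeEven-chainᵉ j d (suc y) ls                 = ℕ.z<s , gap-even-even j , decodeEven-chainᵉ j d y ls
    decodeEven-chainᵉ j d zero    []                 = tt
    decodeEven-chainᵉ j d zero    ((s , x , y) ∷ ls) = decodeLayer-chainᵉ j d s x y ls

    decodeLayer-chainᵒ : ∀ j d s x y ls → Chain (odd j) (oddColour d) (decodeLayer j d s x y ls)
    decodeLayer-chainᵒ j d false x y ls = ℕ.z<s , gap-same j d , decodeOdd-chain (suc j) d x y ls
    decodeLayer-chainᵒ j d true  x y ls = ℕ.z<s , gap-odd-even j d ,
                                          ℕ.z<s , gap-even-odd j (not d) , decodeOdd-chain (suc j) (not d) x y ls

    decodeLayer-chainᵉ : ∀ j d s x y ls → Chain (even j) b (decodeLayer j d s x y ls)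
    decodeLayer-chainᵉ j d false x y ls = ℕ.z<s , gap-even-odd j d , decodeOdd-chain (suc j) d x y ls
    decodeLayer-chainᵉ j d true  x y ls = ℕ.z<s , gap-even-even j ,
                                          ℕ.z<s , gap-even-odd j (not d) , decodeOdd-chain (suc j) (not d) x y ls

  decode-grounded : ∀ ls → Grounded (decode ls)
  decode-grounded []                 = tt
  decode-grounded ((s , x , y) ∷ ls) = ℕ.z<s , gap-ground s , decodeOdd-chain 0 s x y ls

  isOdd-double : ∀ j → isOdd (2 * j) ≡ 0
  isOdd-double zero    = refl
  isOdd-double (suc j) = trans (cong isOdd (ℕP.*-suc 2 j)) (isOdd-double j)

  isOdd-odd : ∀ j → isOdd (odd j) ≡ 1
  isOdd-odd zero    = refl
  isOdd-odd (suc j) = trans (cong (λ n → isOdd (suc n)) (ℕP.*-suc 2 j)) (isOdd-odd j)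

  mutual
    oddParts-decodeOdd : ∀ j d x y ls → oddParts (decodeOdd j d x y ls) ≡ x + layersOdd ls
    oddParts-decodeOdd j d zero    y ls = oddParts-decodeEven j d y ls
    oddParts-decodeOdd j d (suc x) y ls = cong₂ _+_ (isOdd-odd j) (oddParts-decodeOdd j (not d) x y ls)

    oddParts-decodeEven : ∀ j d y ls → oddParts (decodeEven j d y ls) ≡ layersOdd ls
    oddParts-decodeEven j d (suc y) ls                 = cong₂ _+_ (isOdd-double j) (oddParts-decodeEven j d y ls)
    oddParts-decodeEven j d zero    []                 = refl
    oddParts-decodeEven j d zero    ((s , x , y) ∷ ls) = oddParts-decodeLayer j d s x y ls

    oddParts-decodeLayer : ∀ j d s x y ls → oddParts (decodeLayer j d s x y ls) ≡ suc x + layersOdd ls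
    oddParts-decodeLayer j d false x y ls = cong₂ _+_ (isOdd-odd (suc j)) (oddParts-decodeOdd (suc j) d x y ls)
    oddParts-decodeLayer j d true  x y ls =
      cong₂ _+_ (isOdd-double j) (cong₂ _+_ (isOdd-odd (suc j)) (oddParts-decodeOdd (suc j) (not d) x y ls))

  oddParts-decode : ∀ ls → oddParts (decode ls) ≡ layersOdd ls
  oddParts-decode []                 = refl
  oddParts-decode ((s , x , y) ∷ ls) = cong suc (oddParts-decodeOdd 0 s x y ls)

  private
    shift-odd : ∀ o xo ye L → o + (xo + ye + L) ≡ o + xo + ye + L
    shift-odd = solve-∀
    shift-layer : ∀ o xo ye L → o + (xo + ye + L) ≡ o + xo + ye + 0 + L
    shift-layer = solve-∀
    shift-switch : ∀ e o xo ye L → e + (o + (xo + ye + L)) ≡ o + xo + ye + e + L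
    shift-switch = solve-∀

  mutual
    weight-decodeOdd : ∀ j d x y ls → weight (decodeOdd j d x y ls) ≡ x * odd j + y * even j + layersWeight (suc j) ls
    weight-decodeOdd j d zero    y ls = weight-decodeEven j d y ls
    weight-decodeOdd j d (suc x) y ls =
      trans (cong (odd j +_) (weight-decodeOdd j (not d) x y ls)) (shift-odd (odd j) (x * odd j) _ _)

    weight-decodeEven : ∀ j d y ls → weight (decodeEven j d y ls) ≡ y * even j + layersWeight (suc j) ls
    weight-decodeEven j d (suc y) ls =
      trans (cong (even j +_) (weight-decodeEven j d y ls)) (sym (ℕP.+-assoc (even j) (y * even j) _))
    weight-decodeEven j d zero    []                 = refl
    weight-decodeEven j d zero    ((s , x , y) ∷ ls) = weight-decodeLayer j d s x y ls

    weight-decodeLayer : ∀ j d s x y ls → weight (decodeLayer j d s x y ls) ≡ layersWeight (suc j) ((s , x , y) ∷ ls)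
    weight-decodeLayer j d false x y ls =
      trans (cong (odd (suc j) +_) (weight-decodeOdd (suc j) d x y ls)) (shift-layer (odd (suc j)) (x * odd (suc j)) _ _)
    weight-decodeLayer j d true  x y ls = begin
      even j + (odd (suc j) + weight (decodeOdd (suc j) (not d) x y ls))
        ≡⟨ cong (λ w → even j + (odd (suc j) + w)) (weight-decodeOdd (suc j) (not d) x y ls) ⟩
      even j + (odd (suc j) + (x * odd (suc j) + y * even (suc j) + layersWeight (suc (suc j)) ls))
        ≡⟨ shift-switch (even j) (odd (suc j)) (x * odd (suc j)) _ _ ⟩
      suc x * odd (suc j) + y * even (suc j) + even j + layersWeight (suc (suc j)) ls
        ≡⟨ cong (λ e → suc x * odd (suc j) + y * even (suc j) + e + layersWeight (suc (suc j)) ls) (ℕP.*-suc 2 j) ⟨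
      layersWeight (suc j) ((true , x , y) ∷ ls) ∎
      where open ≡-Reasoning

  weight-decode : ∀ ls → weight (decode ls) ≡ layersWeight 0 ls
  weight-decode []                     = refl
  weight-decode ((false , x , y) ∷ ls) = trans (cong suc (weight-decodeOdd 0 false x y ls)) (shift-layer 1 (x * 1) _ _)
  weight-decode ((true  , x , y) ∷ ls) = trans (cong suc (weight-decodeOdd 0 true x y ls)) (shift-layer 1 (x * 1) _ _)

  parseOdd-same : ∀ d w l → parseOdd d ((w , oddColour d) ∷ l) ≡ (0 , 0 , consLayer false (parseOdd d l))
  parseOdd-same d w l = cong (parseOddStep d l) (step-same d)

  parseOdd-switch : ∀ d w l → parseOdd d ((w , oddColour (not d)) ∷ l) ≡ map₁ suc (parseOdd (not d) l)
  parseOdd-switch d w l = cong (parseOddStep d l) (step-switch d)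

  parseOdd-middle : ∀ d w l → parseOdd d ((w , b) ∷ l) ≡ (0 , parseEven d l)
  parseOdd-middle d w l = cong (parseOddStep d l) (step-middle d)

  parseEven-same : ∀ d w l → parseEven d ((w , oddColour d) ∷ l) ≡ (1 , consLayer false (parseOdd d l))
  parseEven-same d w l = cong (parseEvenStep d l) (step-same d)

  parseEven-switch : ∀ d w l → parseEven d ((w , oddColour (not d)) ∷ l) ≡ (0 , consLayer true (parseOdd (not d) l))
  parseEven-switch d w l = cong (parseEvenStep d l) (step-switch d)

  parseEven-middle : ∀ d w l → parseEven d ((w , b) ∷ l) ≡ map₁ suc (parseEven d l)
  parseEven-middle d w l = cong (parseEvenStep d l) (step-middle d)

  mutual
    parseOdd-decodeOdd : ∀ j d x y ls → parseOdd d (decodeOdd j d x y ls) ≡ (x , y , ls)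
    parseOdd-decodeOdd j d zero    y ls = parseOdd-decodeEven j d y ls
    parseOdd-decodeOdd j d (suc x) y ls =
      trans (parseOdd-switch d (odd j) _) (cong (map₁ suc) (parseOdd-decodeOdd j (not d) x y ls))

    parseOdd-decodeEven : ∀ j d y ls → parseOdd d (decodeEven j d y ls) ≡ (0 , y , ls)
    parseOdd-decodeEven j d (suc y) ls = trans (parseOdd-middle d (even j) _) (cong (0 ,_) (parseEven-decodeEven j d y ls))
    parseOdd-decodeEven j d zero    [] = refl
    parseOdd-decodeEven j d zero    ((false , x , y) ∷ ls) =
      trans (parseOdd-same d (odd (suc j)) _) (cong (λ p → 0 , 0 , consLayer false p) (parseOdd-decodeOdd (suc j) d x y ls))
    parseOdd-decodeEven j d zero    ((true , x , y) ∷ ls) =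
      trans (parseOdd-middle d (even j) _) (cong (0 ,_) (parseEven-switchLayer j d x y ls))

    parseEven-decodeEven : ∀ j d y ls → parseEven d (decodeEven j d y ls) ≡ (suc y , ls)
    parseEven-decodeEven j d (suc y) ls = trans (parseEven-middle d (even j) _) (cong (map₁ suc) (parseEven-decodeEven j d y ls))
    parseEven-decodeEven j d zero    [] = refl
    parseEven-decodeEven j d zero    ((false , x , y) ∷ ls) =
      trans (parseEven-same d (odd (suc j)) _) (cong (λ p → 1 , consLayer false p) (parseOdd-decodeOdd (suc j) d x y ls))
    parseEven-decodeEven j d zero    ((true , x , y) ∷ ls) =
      trans (parseEven-middle d (even j) _) (cong (map₁ suc) (parseEven-switchLayer j d x y ls))

    parseEven-switchLayer : ∀ j d x y ls →
      parseEven d ((odd (suc j) , oddColour (not d)) ∷ decodeOdd (suc j) (not d) x y ls) ≡ (0 , (true , x , y) ∷ ls)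
    parseEven-switchLayer j d x y ls =
      trans (parseEven-switch d (odd (suc j)) _) (cong (λ p → 0 , consLayer true p) (parseOdd-decodeOdd (suc j) (not d) x y ls))

  parse-decode : ∀ ls → parse (decode ls) ≡ ls
  parse-decode []                     = refl
  parse-decode ((false , x , y) ∷ ls) = cong (consLayer false) (parseOdd-decodeOdd 0 false x y ls)
  parse-decode ((true  , x , y) ∷ ls) = cong (consLayer true) (parseOdd-decodeOdd 0 true x y ls)

  chain-subst : ∀ {v w p l} → v ≡ w → Chain v p l → Chain w p l
  chain-subst refl ch = ch

  decodeOddᵖ : ℕ → Bool → ℕ × ℕ × List Layer → ColouredSeq
  decodeOddᵖ j d (x , y , ls) = decodeOdd j d x y ls

  decodeEvenᵖ : ℕ → Bool → ℕ × List Layer → ColouredSeq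
  decodeEvenᵖ j d (y , ls) = decodeEven j d y ls

  mutual
    decode-parseOdd : ∀ j d l → Chain (odd j) (oddColour d) l → decodeOddᵖ j d (parseOdd d l) ≡ l
    decode-parseOdd j d [] _ = refl
    decode-parseOdd j d ((w , r) ∷ l) (_ , w≡ , ch) with step d r
    ... | same   = cong₂ _∷_ (cong (_, oddColour d) (sym w≡odd)) (decode-parseOdd (suc j) d l (chain-subst w≡odd ch))
      where w≡odd : w ≡ odd (suc j)
            w≡odd = trans w≡ (sym (gap-same j d))
    ... | switch = cong₂ _∷_ (cong (_, oddColour (not d)) (sym w≡odd)) (decode-parseOdd j (not d) l (chain-subst w≡odd ch))
      where w≡odd : w ≡ odd j
            w≡odd = trans w≡ (sym (gap-switch j d))
    ... | middle = trans (decode-parseEven j d l (chain-subst w≡even ch)) (cong (λ u → (u , b) ∷ l) (sym w≡even))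
      where w≡even : w ≡ even j
            w≡even = trans w≡ (sym (gap-odd-even j d))

    decode-parseEven : ∀ j d l → Chain (even j) b l → decodeEvenᵖ j d (parseEven d l) ≡ (even j , b) ∷ l
    decode-parseEven j d [] _ = refl
    decode-parseEven j d ((w , r) ∷ l) (_ , w≡ , ch) with step d r
    ... | same   = cong ((even j , b) ∷_) (cong₂ _∷_ (cong (_, oddColour d) (sym w≡odd))
                                                     (decode-parseOdd (suc j) d l (chain-subst w≡odd ch)))
      where w≡odd : w ≡ odd (suc j)
            w≡odd = trans w≡ (sym (gap-even-odd j d))
    ... | switch = cong ((even j , b) ∷_) (cong₂ _∷_ (cong (_, oddColour (not d)) (sym w≡odd))
                                                     (decode-parseOdd (suc j) (not d) l (chain-subst w≡odd ch)))
      where w≡odd : w ≡ odd (suc j)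
            w≡odd = trans w≡ (sym (gap-even-odd j (not d)))
    ... | middle = cong ((even j , b) ∷_) (trans (decode-parseEven j d l (chain-subst w≡even ch))
                                                 (cong (λ u → (u , b) ∷ l) (sym w≡even)))
      where w≡even : w ≡ even j
            w≡even = trans w≡ (sym (gap-even-even j))

  decode-parse : ∀ l → Grounded l → decode (parse l) ≡ l
  decode-parse []            _             = refl
  decode-parse ((w , a) ∷ l) (_ , w≡1 , ch) = cong₂ _∷_ (cong (_, a) (sym w≡1)) (decode-parseOdd 0 false l (chain-subst w≡1 ch))
  decode-parse ((w , b) ∷ l) (0<w , w≡0 , _) = ⊥-elim (ℕP.<-irrefl (sym w≡0) 0<w)
  decode-parse ((w , c) ∷ l) (_ , w≡1 , ch) = cong₂ _∷_ (cong (_, c) (sym w≡1)) (decode-parseOdd 0 true l (chain-subst w≡1 ch))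

  chain-irrelevant : ∀ v p l (ch ch′ : Chain v p l) → ch ≡ ch′
  chain-irrelevant v p []            tt                tt                   = refl
  chain-irrelevant v p ((w , r) ∷ l) (0<w , w≡ , ch) (0<w′ , w≡′ , ch′) =
    cong₂ _,_ (ℕP.≤-irrelevant 0<w 0<w′) (cong₂ _,_ (ℕP.≡-irrelevant w≡ w≡′) (chain-irrelevant w r l ch ch′))

  grounded↔layers : ∀ k N → GP k N ↔ Fibre (List Layer) layersOdd (layersWeight 0) k N
  grounded↔layers k N = mk↔ₛ′ to from to∘from from∘to
    where
    to : GP k N → Fibre (List Layer) layersOdd (layersWeight 0) k N
    to (l , grounded , odd≡k , weight≡N) =
      parse l , trans (sym (oddParts-decode (parse l))) (trans (cong oddParts (decode-parse l grounded)) odd≡k)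
              , trans (sym (weight-decode (parse l))) (trans (cong weight (decode-parse l grounded)) weight≡N)
    from : Fibre (List Layer) layersOdd (layersWeight 0) k N → GP k N
    from (ls , odd≡k , weight≡N) = decode ls , decode-grounded ls , trans (oddParts-decode ls) odd≡k , trans (weight-decode ls) weight≡N
    to∘from : ∀ z → to (from z) ≡ z
    to∘from (ls , _) = Counting.fibre-≡ (parse-decode ls)
    from∘to : ∀ z → from (to z) ≡ z
    from∘to (l , grounded , odd≡k , weight≡N) = same-partition (decode-parse l grounded)
      where
      same-partition : ∀ {l′} {p : Grounded l′ × (oddParts l′ ≡ k) × (weight l′ ≡ N)} → l′ ≡ l →
                       _≡_ {A = GP k N} (l′ , p) (l , grounded , odd≡k , weight≡N)
      same-partition {p = grounded′ , odd≡k′ , weight≡N′} refl =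
        cong₂ (λ g e → l , g , e) (chain-irrelevant 0 b l grounded′ grounded)
              (cong₂ _,_ (ℕP.≡-irrelevant odd≡k′ odd≡k) (ℕP.≡-irrelevant weight≡N′ weight≡N))

open Counting using (Enumerates; enumerates-Σ; fibre-↔)
open Layers
open import Data.Integer using (+_)

enumerates-rhs : Enumerates rhsCoeff (Σ ℕ Layers) (λ (n , ls) → layersOddᵛ n ls) (λ (n , ls) → layersWeightᵛ 0 n ls)
enumerates-rhs = enumerates-Σ RightHandSide.enumerates-rhsTerm (n≤layersWeightᵛ 0)

lemma2p4 : (k N : ℕ) →
    Σ ℕ (λ m → (rhsCoeff k N ≡ + m) × (GP k N ↔ Fin m))
lemma2p4 k N with enumerates-rhs k N
... | m , coefficient , layers↔Fin =
  m , coefficient ,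
  ↔-trans (GroundedPartitions.grounded↔layers k N)
          (↔-trans (↔-sym (fibre-↔ Σlayers↔list (λ (n , ls) → layersOdd-toList n ls) (λ (n , ls) → layersWeight-toList 0 n ls) k N))
                   layers↔Fin)
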